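{- Let $(G,\omega)$ be a weighted graph with $n$ vertices and total weight $N=\sum_{v}\omega(v)$. Then, as identities of rational functions in $x$, (1) $\chi_G(x)=(x-1)^N\,\tau_{(G,\omega)}\!\left(\frac{x}{x-1}\right)$, and (2) $\tau_{(G,\omega)}(x)=(x-1)^N\,\chi_G\!\left(\frac{x}{x-1}\right)$, where $\chi_G$ is the chromatic polynomial of the underlying graph $G$.
   Context: All graphs are finite and simple. A weighted graph is $(G,\omega)$ with $\omega:V(G)\to\mathbb{Z}_{>0}$; its chromatic symmetric function is $X_{(G,\omega)}=\sum_\kappa\prod_{v}x_{\kappa(v)}^{\omega(v)}$ over proper colourings $\kappa:V(G)\to\mathbb{Z}_{>0}$. For a partition $\lambda=(\lambda_1,\dots,\lambda_\ell)$, $\ell(\lambda)=\ell$ and $P_\lambda$ is the disjoint union of paths with $\lambda_1,\dots,\lambda_\ell$ vertices; $\{X_{P_\lambda}\}$ is a basis of the symmetric functions over $\mathbb{Q}$. The tree polynomial is $\tau_{(G,\omega)}(x)=\sum_\lambda a_\lambda x^{\ell(\lambda)}$ where $X_{(G,\omega)}=\sum_\lambda a_\lambda X_{P_\lambda}$. -}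

module Defs where

open import Data.Nat as ℕ using (ℕ; zero; suc)
open import Data.Bool using (Bool; true; false; _∧_; _∨_; if_then_else_)
open import Data.Fin using (Fin; toℕ)
open import Data.Fin.Properties using () renaming (_≟_ to _≟ᶠ_)
open import Data.Vec as Vec using (Vec; []; _∷_; lookup)
open import Data.List as List using (List; []; _∷_; _++_; concatMap; filter; length; allFin)
open import Data.Rational as ℚ using (ℚ; 0ℚ; 1ℚ; _÷_; ≢-nonZero)
open import Data.Nat.ListAction using () renaming (sum to sumℕ)
open import Relation.Nullary.Decidable using (⌊_⌋)
open import Relation.Binary.PropositionalEquality using (_≡_; _≢_)

Adj : ℕ → Set
Adj n = Fin n → Fin n → Bool

IsSimple : ∀ {n} → Adj n → Set
IsSimple {n} adj = (∀ (u v : Fin n) → adj u v ≡ adj v u) × (∀ (v : Fin n) → adj v v ≡ false)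
  where open import Data.Product using (_×_)

Positive : ∀ {n} → (Fin n → ℕ) → Set
Positive {n} ω = ∀ (v : Fin n) → 1 ℕ.≤ ω v

allMaps : (n k : ℕ) → List (Vec (Fin k) n)
allMaps zero    k = [] ∷ []
allMaps (suc n) k = concatMap (λ c → List.map (c ∷_) (allMaps n k)) (allFin k)

countTrue : List Bool → ℕ
countTrue []           = 0
countTrue (true  ∷ bs) = suc (countTrue bs)
countTrue (false ∷ bs) = countTrue bs

allB : ∀ {m} → (Fin m → Bool) → Bool
allB {m} p = List.foldr (λ i b → p i ∧ b) true (allFin m)

isProper : ∀ {n k} → Adj n → Vec (Fin k) n → Bool
isProper adj c = allB (λ u → allB (λ v → if adj u v then Data.Bool.not ⌊ lookup c u ≟ᶠ lookup c v ⌋ else true))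
  where import Data.Bool

numProper : ∀ {n} → Adj n → ℕ → ℕ
numProper {n} adj k = countTrue (List.map (isProper adj) (allMaps n k))

-- For a weight vector μ = (μ₁,…,μ_ℓ), coeffX adj ω μ is the coefficient of
-- x₁^μ₁ ⋯ x_ℓ^μ_ℓ in X_(G,ω) = Σ_κ Π_v x_κ(v)^ω(v): the number of proper
-- colourings κ : V → {1,…,ℓ} whose colour class i has total weight μ_i.
-- (Since weights are positive, colourings using a colour > ℓ never
-- contribute to this monomial.)

classWeight : ∀ {n ℓ} → (Fin n → ℕ) → Vec (Fin ℓ) n → Fin ℓ → ℕ
classWeight {n} ω c i = sumℕ (List.map (λ v → if ⌊ lookup c v ≟ᶠ i ⌋ then ω v else 0) (allFin n))

weightsMatch : ∀ {n} → (Fin n → ℕ) → (μ : List ℕ) → Vec (Fin (length μ)) n → Bool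
weightsMatch ω μ c = allB (λ i → ⌊ classWeight ω c i ℕ.≟ List.lookup μ i ⌋)

coeffX : ∀ {n} → Adj n → (Fin n → ℕ) → List ℕ → ℕ
coeffX {n} adj ω μ =
  countTrue (List.map (λ c → isProper adj c ∧ weightsMatch ω μ c) (allMaps n (length μ)))

-- parts f r b : all partitions of r with all parts ≤ b (f is fuel, f ≥ r suffices)
parts : ℕ → ℕ → ℕ → List (List ℕ)
parts _        zero    b = [] ∷ []
parts zero     (suc r) b = []
parts (suc f)  (suc r) b =
  concatMap (λ q → List.map (q ∷_) (parts f (suc r ℕ.∸ q) q))
            (filter (λ q → q ℕ.≤? b) (List.map suc (List.upTo (suc r))))

partitions : ℕ → List (List ℕ)
partitions N = parts N N N

-- The path forest P_λ: vertices 0,…,|λ|-1, consecutive blocks of sizes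
-- λ₁, λ₂, … each forming a path; all weights 1.

blockOf : List ℕ → ℕ → ℕ
blockOf []       i = 0
blockOf (p ∷ ps) i = if ⌊ i ℕ.<? p ⌋ then 0 else suc (blockOf ps (i ℕ.∸ p))

pathAdj : (λ' : List ℕ) → Adj (sumℕ λ')
pathAdj λ' u v =
  (⌊ suc (toℕ u) ℕ.≟ toℕ v ⌋ ∨ ⌊ suc (toℕ v) ℕ.≟ toℕ u ⌋)
  ∧ ⌊ blockOf λ' (toℕ u) ℕ.≟ blockOf λ' (toℕ v) ⌋

coeffP : List ℕ → List ℕ → ℕ
coeffP λ' μ = coeffX (pathAdj λ') (λ _ → 1) μ

sumℚ : List ℚ → ℚ
sumℚ = List.foldr ℚ._+_ 0ℚ

_^ℚ_ : ℚ → ℕ → ℚ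
x ^ℚ zero  = 1ℚ
x ^ℚ suc k = x ℚ.* (x ^ℚ k)

fromℕℚ : ℕ → ℚ
fromℕℚ k = (+ k) ℚ./ 1
  where open import Data.Integer using (+_)

divℚ : (x y : ℚ) → y ≢ 0ℚ → ℚ
divℚ x y h = _÷_ x y {{≢-nonZero h}}

evalPoly : List ℚ → ℚ → ℚ
evalPoly []       x = 0ℚ
evalPoly (c ∷ cs) x = c ℚ.+ x ℚ.* evalPoly cs x

-- The path-basis expansion and the tree polynomial.
-- a : List ℕ → ℚ is a family of coefficients a_λ (λ ⊢ N) with
--   X_(G,ω) = Σ_{λ ⊢ N} a_λ X_{P_λ},
-- checked coefficientwise on the monomials x^μ, μ ⊢ N (both sides are
-- homogeneous symmetric functions of degree N = total weight).

IsPathExpansion : ∀ {n} → Adj n → (Fin n → ℕ) → (List ℕ → ℚ) → Set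
IsPathExpansion {n} adj ω a =
  ∀ μ → μ ∈ partitions N →
    fromℕℚ (coeffX adj ω μ) ≡ sumℚ (List.map (λ λ' → a λ' ℚ.* fromℕℚ (coeffP λ' μ)) (partitions N))
  where
    open import Data.List.Membership.Propositional using (_∈_)
    N = sumℕ (List.map ω (allFin n))

totalWeight : ∀ {n} → (Fin n → ℕ) → ℕ
totalWeight {n} ω = sumℕ (List.map ω (allFin n))

treePoly : ℕ → (List ℕ → ℚ) → ℚ → ℚ
treePoly N a x = sumℚ (List.map (λ λ' → a λ' ℚ.* (x ^ℚ length λ')) (partitions N))

IsChromaticPoly : ∀ {n} → Adj n → List ℚ → Set
IsChromaticPoly adj p = ∀ (k : ℕ) → evalPoly p (fromℕℚ k) ≡ fromℕℚ (numProper adj k)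

{-# OPTIONS --safe #-}
-- Sort the proper k-colourings of G by the vector β of total weights of their colour classes.
-- Relabelling the colours and deleting empty classes turns β into a partition μ of N, and the
-- number of proper colourings with class weights μ is the coefficient of x^μ in X_(G,ω). So the
-- path expansion X_(G,ω) = Σ a_λ X_{P_λ}, read on these coefficients, passes to chromatic
-- polynomials: χ_G(k) = Σ_λ a_λ χ_{P_λ}(k) = Σ_λ a_λ k^ℓ(λ) (k−1)^(N−ℓ(λ)) for all k ≥ 1.
-- Both sides are polynomials in k, hence equal everywhere, and writing x = (x−1)·x/(x−1) gives (1).
-- As y = x/(x−1) satisfies (x−1)(y−1) = 1 and y/(y−1) = x, (2) is (1) evaluated at y.
module Submission where

module Counting where

  open import Data.Nat using (ℕ; zero; suc; _+_; _*_; _∸_; _≤_; _≟_; s≤s; +-0-rawMonoid)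
  open import Data.Nat.Properties
  open import Data.Bool using (Bool; true; false; _∧_; not; if_then_else_)
  open import Data.Bool.Properties using (∧-conicalˡ; ∧-conicalʳ)
  open import Data.Fin using (Fin; zero; suc; toℕ)
  open import Data.Fin.Properties using () renaming (_≟_ to _≟ᶠ_; suc-injective to Fin-suc-injective)
  open import Data.Fin.Permutation using (Permutation′; _⟨$⟩ʳ_; _⟨$⟩ˡ_; inverseʳ)
  open import Data.Vec using (Vec; _∷_)
  open import Data.List using (List; []; _∷_; _++_; map; concatMap; allFin; foldr; length)
  open import Data.List.Properties using (map-tabulate; foldr-map)
  open import Data.List.Membership.Propositional using (_∈_)
  open import Data.List.Relation.Unary.Any using (here; there)
  open import Data.Nat.ListAction using () renaming (sum to sumℕ)
  open import Algebra.Properties.CommutativeSemigroup +-commutativeSemigroup using (interchange)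
  open import Algebra.Definitions.RawMonoid +-0-rawMonoid using () renaming (sum to vecSum)
  import Algebra.Properties.CommutativeMonoid.Sum +-0-commutativeMonoid as MonoidSum
  open import Relation.Nullary using (¬_; Dec; yes; no; contradiction)
  open import Relation.Nullary.Decidable using (⌊_⌋; ⌊⌋-map′)
  open import Function.Definitions using (Injective)
  open import Relation.Binary.PropositionalEquality
  open import Function using (_∘_; id)
  open import Defs

  bit : Bool → ℕ
  bit true  = 1
  bit false = 0

  bit-∧ : ∀ x y → bit (x ∧ y) ≡ bit x * bit y
  bit-∧ true  y = sym (+-identityʳ (bit y))
  bit-∧ false y = refl

  bit≡0 : ∀ {x} → ¬ x ≡ true → bit x ≡ 0
  bit≡0 {false} _     = refl
  bit≡0 {true}  x≢true = contradiction refl x≢true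

  ∑ : {A : Set} → List A → (A → ℕ) → ℕ
  ∑ L f = sumℕ (map f L)

  countTrue-map : {A : Set} (p : A → Bool) (L : List A) → countTrue (map p L) ≡ ∑ L (bit ∘ p)
  countTrue-map p [] = refl
  countTrue-map p (x ∷ L) with p x
  ... | true  = cong suc (countTrue-map p L)
  ... | false = countTrue-map p L

  ∑-++ : {A : Set} (L M : List A) (f : A → ℕ) → ∑ (L ++ M) f ≡ ∑ L f + ∑ M f
  ∑-++ []      M f = refl
  ∑-++ (x ∷ L) M f = trans (cong (f x +_) (∑-++ L M f)) (sym (+-assoc (f x) (∑ L f) (∑ M f)))

  ∑-concatMap : {A B : Set} (g : A → List B) (L : List A) (f : B → ℕ) →
    ∑ (concatMap g L) f ≡ ∑ L (λ x → ∑ (g x) f)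
  ∑-concatMap g []      f = refl
  ∑-concatMap g (x ∷ L) f = trans (∑-++ (g x) (concatMap g L) f) (cong (∑ (g x) f +_) (∑-concatMap g L f))

  ∑-map : {A B : Set} (h : A → B) (L : List A) (f : B → ℕ) → ∑ (map h L) f ≡ ∑ L (f ∘ h)
  ∑-map h []      f = refl
  ∑-map h (x ∷ L) f = cong (f (h x) +_) (∑-map h L f)

  ∑-cong : {A : Set} (L : List A) {f g : A → ℕ} → (∀ x → f x ≡ g x) → ∑ L f ≡ ∑ L g
  ∑-cong []      e = refl
  ∑-cong (x ∷ L) e = cong₂ _+_ (e x) (∑-cong L e)

  ∑-+ : {A : Set} (L : List A) (f g : A → ℕ) → ∑ L (λ x → f x + g x) ≡ ∑ L f + ∑ L g
  ∑-+ []      f g = refl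
  ∑-+ (x ∷ L) f g = trans (cong (f x + g x +_) (∑-+ L f g)) (interchange (f x) (g x) (∑ L f) (∑ L g))

  ∑-*ˡ : {A : Set} (L : List A) (c : ℕ) (f : A → ℕ) → ∑ L (λ x → c * f x) ≡ c * ∑ L f
  ∑-*ˡ []      c f = sym (*-zeroʳ c)
  ∑-*ˡ (x ∷ L) c f = trans (cong (c * f x +_) (∑-*ˡ L c f)) (sym (*-distribˡ-+ c (f x) (∑ L f)))

  ∑-*ʳ : {A : Set} (L : List A) (c : ℕ) (f : A → ℕ) → ∑ L (λ x → f x * c) ≡ ∑ L f * c
  ∑-*ʳ L c f = trans (∑-cong L (λ x → *-comm (f x) c)) (trans (∑-*ˡ L c f) (*-comm c (∑ L f)))

  ∑-zero : {A : Set} (L : List A) {f : A → ℕ} → (∀ x → f x ≡ 0) → ∑ L f ≡ 0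
  ∑-zero L e = trans (∑-cong L e) (∑-0 L)
    where
    ∑-0 : {A : Set} (L : List A) → ∑ L (λ _ → 0) ≡ 0
    ∑-0 []      = refl
    ∑-0 (x ∷ L) = ∑-0 L

  ∑-comm : {A B : Set} (L : List A) (M : List B) (f : A → B → ℕ) →
    ∑ L (λ x → ∑ M (f x)) ≡ ∑ M (λ y → ∑ L (λ x → f x y))
  ∑-comm []      M f = sym (∑-zero M (λ _ → refl))
  ∑-comm (x ∷ L) M f =
    trans (cong (∑ M (f x) +_) (∑-comm L M f)) (sym (∑-+ M (f x) (λ y → ∑ L (λ x → f x y))))

  ∑-1 : {A : Set} (L : List A) → ∑ L (λ _ → 1) ≡ length L
  ∑-1 []      = refl
  ∑-1 (x ∷ L) = cong suc (∑-1 L)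

  ≤-∑ : {A : Set} (L : List A) (f : A → ℕ) {x : A} → x ∈ L → f x ≤ ∑ L f
  ≤-∑ (y ∷ L) f (here refl) = m≤m+n (f y) (∑ L f)
  ≤-∑ (y ∷ L) f (there x∈L) = ≤-trans (≤-∑ L f x∈L) (m≤n+m (∑ L f) (f y))

  allFin-suc : ∀ k → allFin (suc k) ≡ zero ∷ map suc (allFin k)
  allFin-suc k = cong (zero ∷_) (sym (map-tabulate id suc))

  ∑Fin : ∀ k → (Fin k → ℕ) → ℕ
  ∑Fin k = ∑ (allFin k)

  ∑Fin-suc : ∀ k (f : Fin (suc k) → ℕ) → ∑Fin (suc k) f ≡ f zero + ∑Fin k (f ∘ suc)
  ∑Fin-suc k f = trans (cong (λ L → ∑ L f) (allFin-suc k)) (cong (f zero +_) (∑-map suc (allFin k) f))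

  ∑Fin-const : ∀ k c → ∑Fin k (λ _ → c) ≡ k * c
  ∑Fin-const zero    c = refl
  ∑Fin-const (suc k) c = trans (∑Fin-suc k (λ _ → c)) (cong (c +_) (∑Fin-const k c))

  ⌊≟⌋-injective : ∀ {k m} {f : Fin k → Fin m} → Injective _≡_ _≡_ f →
    ∀ x y → ⌊ f x ≟ᶠ f y ⌋ ≡ ⌊ x ≟ᶠ y ⌋
  ⌊≟⌋-injective {f = f} inj x y with f x ≟ᶠ f y | x ≟ᶠ y
  ... | yes _  | yes _  = refl
  ... | no _   | no _   = refl
  ... | yes e  | no x≢y = contradiction (inj e) x≢y
  ... | no fx≢fy | yes e = contradiction (cong f e) fx≢fy

  ⌊suc≟suc⌋ : ∀ {k} (x y : Fin k) → ⌊ suc x ≟ᶠ suc y ⌋ ≡ ⌊ x ≟ᶠ y ⌋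
  ⌊suc≟suc⌋ = ⌊≟⌋-injective Fin-suc-injective

  ⌊suc≟suc⌋ℕ : ∀ m n → ⌊ suc m ≟ suc n ⌋ ≡ ⌊ m ≟ n ⌋
  ⌊suc≟suc⌋ℕ m n = trans (⌊⌋-map′ _ _ _) (sym (⌊⌋-map′ _ _ _))

  ∑Fin-point : ∀ k (x : Fin k) t → ∑Fin k (λ i → if ⌊ x ≟ᶠ i ⌋ then t else 0) ≡ t
  ∑Fin-point (suc k) zero t =
    trans (∑Fin-suc k (λ i → if ⌊ zero ≟ᶠ i ⌋ then t else 0))
          (trans (cong (t +_) (∑-zero (allFin k) (λ _ → refl))) (+-identityʳ t))
  ∑Fin-point (suc k) (suc x) t =
    trans (∑Fin-suc k (λ i → if ⌊ suc x ≟ᶠ i ⌋ then t else 0))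
          (trans (∑-cong (allFin k) (λ i → cong (λ b → if b then t else 0) (⌊suc≟suc⌋ x i)))
                 (∑Fin-point k x t))

  ∑Fin-≢ : ∀ k (d : Fin k) → ∑Fin k (λ c → bit (not ⌊ c ≟ᶠ d ⌋)) ≡ k ∸ 1
  ∑Fin-≢ (suc k) zero =
    trans (∑Fin-suc k (λ c → bit (not ⌊ c ≟ᶠ zero ⌋))) (trans (∑Fin-const k 1) (*-identityʳ k))
  ∑Fin-≢ (suc (suc k)) (suc d) =
    trans (∑Fin-suc (suc k) (λ c → bit (not ⌊ c ≟ᶠ suc d ⌋)))
          (cong suc (trans (∑-cong (allFin (suc k)) (λ c → cong (bit ∘ not) (⌊suc≟suc⌋ c d)))
                           (∑Fin-≢ (suc k) d)))

  ∑Fin-toℕ-point : ∀ B m → m ≤ B → ∑Fin (suc B) (λ a → bit ⌊ m ≟ toℕ a ⌋) ≡ 1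
  ∑Fin-toℕ-point B zero le =
    trans (∑Fin-suc B (λ a → bit ⌊ 0 ≟ toℕ a ⌋)) (cong suc (∑-zero (allFin B) (λ _ → refl)))
  ∑Fin-toℕ-point (suc B) (suc m) (s≤s le) =
    trans (∑Fin-suc (suc B) (λ a → bit ⌊ suc m ≟ toℕ a ⌋))
          (trans (∑-cong (allFin (suc B)) (λ a → cong bit (⌊suc≟suc⌋ℕ m (toℕ a))))
                 (∑Fin-toℕ-point B m le))

  ∑Fin-permute : ∀ k (f : Fin k → ℕ) (π : Permutation′ k) → ∑Fin k f ≡ ∑Fin k (f ∘ (π ⟨$⟩ʳ_))
  ∑Fin-permute k f π = trans (∑Fin≡vecSum k f) (trans (MonoidSum.sum-permute f π) (sym (∑Fin≡vecSum k _)))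
    where
    ∑Fin≡vecSum : ∀ k (f : Fin k → ℕ) → ∑Fin k f ≡ vecSum f
    ∑Fin≡vecSum zero    f = refl
    ∑Fin≡vecSum (suc k) f = trans (∑Fin-suc k f) (cong (f zero +_) (∑Fin≡vecSum k (f ∘ suc)))

  ∑-allMaps-suc : ∀ n k (f : Vec (Fin k) (suc n) → ℕ) →
    ∑ (allMaps (suc n) k) f ≡ ∑Fin k (λ c₀ → ∑ (allMaps n k) (λ c → f (c₀ ∷ c)))
  ∑-allMaps-suc n k f = trans (∑-concatMap (λ c₀ → map (c₀ ∷_) (allMaps n k)) (allFin k) f)
                              (∑-cong (allFin k) (λ c₀ → ∑-map (c₀ ∷_) (allMaps n k) f))

  allB-suc : ∀ {m} (p : Fin (suc m) → Bool) → allB p ≡ (p zero ∧ allB (p ∘ suc))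
  allB-suc {m} p = trans (cong (foldr (λ i b → p i ∧ b) true) (allFin-suc m))
                         (cong (p zero ∧_) (foldr-map (λ i b → p i ∧ b) suc true (allFin m)))

  allB⇒ : ∀ {m} (p : Fin m → Bool) → allB p ≡ true → ∀ i → p i ≡ true
  allB⇒ p e zero    = ∧-conicalˡ _ _ (trans (sym (allB-suc p)) e)
  allB⇒ p e (suc i) = allB⇒ (p ∘ suc) (∧-conicalʳ _ _ (trans (sym (allB-suc p)) e)) i

  allB⇐ : ∀ {m} (p : Fin m → Bool) → (∀ i → p i ≡ true) → allB p ≡ true
  allB⇐ {zero}  p h = refl
  allB⇐ {suc m} p h = trans (allB-suc p) (cong₂ _∧_ (h zero) (allB⇐ (p ∘ suc) (h ∘ suc)))

  Bool-ext : {x y : Bool} → (x ≡ true → y ≡ true) → (y ≡ true → x ≡ true) → x ≡ y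
  Bool-ext {false} {false} f g = refl
  Bool-ext {false} {true}  f g = g refl
  Bool-ext {true}  {false} f g = sym (f refl)
  Bool-ext {true}  {true}  f g = refl

  allB-cong : ∀ {m} {p q : Fin m → Bool} → (∀ i → p i ≡ q i) → allB p ≡ allB q
  allB-cong {p = p} {q} e =
    Bool-ext (λ h → allB⇐ q (λ i → trans (sym (e i)) (allB⇒ p h i)))
             (λ h → allB⇐ p (λ i → trans (e i) (allB⇒ q h i)))

  allB-permute : ∀ {m} (p : Fin m → Bool) (π : Permutation′ m) → allB p ≡ allB (p ∘ (π ⟨$⟩ʳ_))
  allB-permute p π =
    Bool-ext (λ h → allB⇐ _ (λ i → allB⇒ p h (π ⟨$⟩ʳ i)))
             (λ h → allB⇐ p (λ i → subst (λ j → p j ≡ true) (inverseʳ π) (allB⇒ _ h (π ⟨$⟩ˡ i))))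

  ⌊⌋≡true⇒ : {P : Set} (p? : Dec P) → ⌊ p? ⌋ ≡ true → P
  ⌊⌋≡true⇒ (yes p) _ = p

  ⇒⌊⌋≡true : {P : Set} (p? : Dec P) → P → ⌊ p? ⌋ ≡ true
  ⇒⌊⌋≡true (yes _) _ = refl
  ⇒⌊⌋≡true (no ¬p) p = contradiction p ¬p

module Colourings where

  open import Data.Nat using (ℕ; zero; suc; _+_; _*_; _≤_; _≟_)
  open import Data.Nat.Properties
  open import Data.Bool using (Bool; true; false; _∧_; not; if_then_else_)
  open import Data.Bool.Properties using (∧-conicalʳ)
  open import Data.Fin using (Fin; zero; suc; toℕ)
  open import Data.Fin.Properties using () renaming (_≟_ to _≟ᶠ_; suc-injective to Fin-suc-injective)
  open import Data.Fin.Permutation using (Permutation′; _⟨$⟩ʳ_)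
  open import Data.Vec as Vec using (Vec; _∷_; lookup)
  open import Data.Vec.Properties using (lookup-map)
  open import Data.List as List using (allFin; length)
  open import Data.List.Membership.Propositional.Properties using (∈-allFin)
  open import Relation.Nullary using (¬_; yes; no; contradiction)
  open import Relation.Nullary.Decidable using (⌊_⌋)
  open import Relation.Binary.PropositionalEquality
  open import Function using (_∘_)
  open import Function.Bundles using (Injection)
  open import Function.Definitions using (Injective)
  open import Function.Properties.Inverse using (↔⇒↣)
  open import Defs
  open Counting

  permutation-injective : ∀ {k} (π : Permutation′ k) → Injective _≡_ _≡_ (π ⟨$⟩ʳ_)
  permutation-injective π = Injection.injective (↔⇒↣ π)

  IsProperColouring : ∀ {n k} → Adj n → Vec (Fin k) n → Set
  IsProperColouring {n} adj c = ∀ (u v : Fin n) → adj u v ≡ true → lookup c u ≢ lookup c v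

  isProper⇒ : ∀ {n k} (adj : Adj n) (c : Vec (Fin k) n) → isProper adj c ≡ true → IsProperColouring adj c
  isProper⇒ adj c h u v uv cu≡cv = contradiction (allB⇒ _ (allB⇒ _ h u) v) edge-rejected
    where
    edge-rejected : ¬ ((if adj u v then not ⌊ lookup c u ≟ᶠ lookup c v ⌋ else true) ≡ true)
    edge-rejected rewrite uv | ⇒⌊⌋≡true (lookup c u ≟ᶠ lookup c v) cu≡cv = λ ()

  isProper⇐ : ∀ {n k} (adj : Adj n) (c : Vec (Fin k) n) → IsProperColouring adj c → isProper adj c ≡ true
  isProper⇐ adj c proper = allB⇐ _ (λ u → allB⇐ _ (λ v → edge-accepted u v (adj u v) refl))
    where
    edge-accepted : ∀ u v b → adj u v ≡ b → (if b then not ⌊ lookup c u ≟ᶠ lookup c v ⌋ else true) ≡ true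
    edge-accepted u v false _  = refl
    edge-accepted u v true  uv with lookup c u ≟ᶠ lookup c v
    ... | yes cu≡cv = contradiction cu≡cv (proper u v uv)
    ... | no _      = refl

  isProper-relabel : ∀ {n k m} (adj : Adj n) {f : Fin k → Fin m} → Injective _≡_ _≡_ f →
    (c : Vec (Fin k) n) → isProper adj (Vec.map f c) ≡ isProper adj c
  isProper-relabel adj {f} inj c = allB-cong (λ u → allB-cong (λ v →
    cong (λ b → if adj u v then not b else true)
         (trans (cong₂ (λ x y → ⌊ x ≟ᶠ y ⌋) (lookup-map u f c) (lookup-map v f c))
                (⌊≟⌋-injective inj (lookup c u) (lookup c v)))))

  classWeight-relabel : ∀ {n k m} (ω : Fin n → ℕ) {f : Fin k → Fin m} → Injective _≡_ _≡_ f →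
    (c : Vec (Fin k) n) (i : Fin k) → classWeight ω (Vec.map f c) (f i) ≡ classWeight ω c i
  classWeight-relabel {n} ω {f} inj c i = ∑-cong (allFin n) (λ v →
    cong (λ b → if b then ω v else 0)
         (trans (cong (λ x → ⌊ x ≟ᶠ f i ⌋) (lookup-map v f c)) (⌊≟⌋-injective inj (lookup c v) i)))

  classWeight-suc-zero : ∀ {n k} (ω : Fin n → ℕ) (c : Vec (Fin k) n) → classWeight ω (Vec.map suc c) zero ≡ 0
  classWeight-suc-zero {n} ω c = ∑-zero (allFin n) (λ v →
    cong (λ x → if ⌊ x ≟ᶠ zero ⌋ then ω v else 0) (lookup-map v suc c))

  ≤-classWeight : ∀ {n k} (ω : Fin n → ℕ) (c : Vec (Fin k) n) v → ω v ≤ classWeight ω c (lookup c v)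
  ≤-classWeight {n} ω c v = subst (_≤ classWeight ω c (lookup c v))
    (cong (λ b → if b then ω v else 0) (⇒⌊⌋≡true (lookup c v ≟ᶠ lookup c v) refl))
    (≤-∑ (allFin n) (λ u → if ⌊ lookup c u ≟ᶠ lookup c v ⌋ then ω u else 0) (∈-allFin v))

  ∑-classWeight : ∀ {n k} (ω : Fin n → ℕ) (c : Vec (Fin k) n) → ∑Fin k (classWeight ω c) ≡ totalWeight ω
  ∑-classWeight {n} {k} ω c =
    trans (∑-comm (allFin k) (allFin n) (λ i v → if ⌊ lookup c v ≟ᶠ i ⌋ then ω v else 0))
          (∑-cong (allFin n) (λ v → ∑Fin-point k (lookup c v) (ω v)))

  hasClassWeights : ∀ {n k} → (Fin n → ℕ) → (Fin k → ℕ) → Vec (Fin k) n → Bool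
  hasClassWeights ω β c = allB (λ i → ⌊ classWeight ω c i ≟ β i ⌋)

  numProperWithWeights : ∀ {n} → Adj n → (Fin n → ℕ) → ∀ k → (Fin k → ℕ) → ℕ
  numProperWithWeights {n} adj ω k β = ∑ (allMaps n k) (λ c → bit (isProper adj c ∧ hasClassWeights ω β c))

  coeffX≡numProperWithWeights : ∀ {n} (adj : Adj n) ω μ →
    coeffX adj ω μ ≡ numProperWithWeights adj ω (length μ) (List.lookup μ)
  coeffX≡numProperWithWeights {n} adj ω μ = countTrue-map _ (allMaps n (length μ))

  numProperWithWeights-cong : ∀ {n} (adj : Adj n) ω k {β β′ : Fin k → ℕ} → (∀ i → β i ≡ β′ i) →
    numProperWithWeights adj ω k β ≡ numProperWithWeights adj ω k β′
  numProperWithWeights-cong {n} adj ω k e = ∑-cong (allMaps n k) (λ c →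
    cong (λ b → bit (isProper adj c ∧ b)) (allB-cong (λ i → cong (λ t → ⌊ classWeight ω c i ≟ t ⌋) (e i))))

  ∑-allMaps-permute : ∀ n k (π : Permutation′ k) (f : Vec (Fin k) n → ℕ) →
    ∑ (allMaps n k) f ≡ ∑ (allMaps n k) (f ∘ Vec.map (π ⟨$⟩ʳ_))
  ∑-allMaps-permute zero    k π f = refl
  ∑-allMaps-permute (suc n) k π f = begin
    ∑ (allMaps (suc n) k) f                                                ≡⟨ ∑-allMaps-suc n k f ⟩
    ∑Fin k (λ c₀ → ∑ (allMaps n k) (λ c → f (c₀ ∷ c)))                      ≡⟨ ∑Fin-permute k _ π ⟩
    ∑Fin k (λ c₀ → ∑ (allMaps n k) (λ c → f ((π ⟨$⟩ʳ c₀) ∷ c)))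
      ≡⟨ ∑-cong (allFin k) (λ c₀ → ∑-allMaps-permute n k π (λ c → f ((π ⟨$⟩ʳ c₀) ∷ c))) ⟩
    ∑Fin k (λ c₀ → ∑ (allMaps n k) (λ c → f ((π ⟨$⟩ʳ c₀) ∷ Vec.map (π ⟨$⟩ʳ_) c))) ≡⟨ ∑-allMaps-suc n k _ ⟨
    ∑ (allMaps (suc n) k) (f ∘ Vec.map (π ⟨$⟩ʳ_))                          ∎
    where open ≡-Reasoning

  ∑-allMaps-avoid-zero : ∀ n k (f : Vec (Fin (suc k)) n → ℕ) → (∀ c v → lookup c v ≡ zero → f c ≡ 0) →
    ∑ (allMaps n (suc k)) f ≡ ∑ (allMaps n k) (f ∘ Vec.map suc)
  ∑-allMaps-avoid-zero zero    k f h = refl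
  ∑-allMaps-avoid-zero (suc n) k f h = begin
    ∑ (allMaps (suc n) (suc k)) f                                      ≡⟨ ∑-allMaps-suc n (suc k) f ⟩
    ∑Fin (suc k) (λ c₀ → ∑ (allMaps n (suc k)) (λ c → f (c₀ ∷ c)))
      ≡⟨ ∑Fin-suc k (λ c₀ → ∑ (allMaps n (suc k)) (λ c → f (c₀ ∷ c))) ⟩
    ∑ (allMaps n (suc k)) (λ c → f (zero ∷ c)) + ∑Fin k (λ c₀ → ∑ (allMaps n (suc k)) (λ c → f (suc c₀ ∷ c)))
      ≡⟨ cong (_+ ∑Fin k (λ c₀ → ∑ (allMaps n (suc k)) (λ c → f (suc c₀ ∷ c))))
              (∑-zero (allMaps n (suc k)) (λ c → h (zero ∷ c) zero refl)) ⟩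
    ∑Fin k (λ c₀ → ∑ (allMaps n (suc k)) (λ c → f (suc c₀ ∷ c)))
      ≡⟨ ∑-cong (allFin k) (λ c₀ → ∑-allMaps-avoid-zero n k (λ c → f (suc c₀ ∷ c)) (λ c v → h (suc c₀ ∷ c) (suc v))) ⟩
    ∑Fin k (λ c₀ → ∑ (allMaps n k) (λ c → f (suc c₀ ∷ Vec.map suc c)))  ≡⟨ ∑-allMaps-suc n k _ ⟨
    ∑ (allMaps (suc n) k) (f ∘ Vec.map suc)                            ∎
    where open ≡-Reasoning

  hasClassWeights⇒ : ∀ {n k} (ω : Fin n → ℕ) (β : Fin k → ℕ) c →
    hasClassWeights ω β c ≡ true → ∀ i → classWeight ω c i ≡ β i
  hasClassWeights⇒ ω β c h i = ⌊⌋≡true⇒ (classWeight ω c i ≟ β i) (allB⇒ _ h i)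

  hasClassWeights-permute : ∀ {n k} (ω : Fin n → ℕ) (β : Fin k → ℕ) (π : Permutation′ k) c →
    hasClassWeights ω β (Vec.map (π ⟨$⟩ʳ_) c) ≡ hasClassWeights ω (β ∘ (π ⟨$⟩ʳ_)) c
  hasClassWeights-permute ω β π c =
    trans (allB-permute (λ i → ⌊ classWeight ω (Vec.map (π ⟨$⟩ʳ_) c) i ≟ β i ⌋) π)
          (allB-cong (λ j → cong (λ w → ⌊ w ≟ β (π ⟨$⟩ʳ j) ⌋)
                                 (classWeight-relabel ω (permutation-injective π) c j)))

  hasClassWeights-suc : ∀ {n k} (ω : Fin n → ℕ) (β : Fin (suc k) → ℕ) → β zero ≡ 0 → ∀ c →
    hasClassWeights ω β (Vec.map suc c) ≡ hasClassWeights ω (β ∘ suc) c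
  hasClassWeights-suc ω β β₀≡0 c =
    trans (allB-suc (λ i → ⌊ classWeight ω (Vec.map suc c) i ≟ β i ⌋))
          (cong₂ _∧_ (⇒⌊⌋≡true (classWeight ω (Vec.map suc c) zero ≟ β zero) (trans (classWeight-suc-zero ω c) (sym β₀≡0)))
                     (allB-cong (λ i → cong (λ w → ⌊ w ≟ β (suc i) ⌋)
                                            (classWeight-relabel ω Fin-suc-injective c i))))

  numProperWithWeights-permute : ∀ {n} (adj : Adj n) ω k (β : Fin k → ℕ) (π : Permutation′ k) →
    numProperWithWeights adj ω k β ≡ numProperWithWeights adj ω k (β ∘ (π ⟨$⟩ʳ_))
  numProperWithWeights-permute {n} adj ω k β π =
    trans (∑-allMaps-permute n k π _)
          (∑-cong (allMaps n k) (λ c → cong bit (cong₂ _∧_ (isProper-relabel adj (permutation-injective π) c)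
                                                         (hasClassWeights-permute ω β π c))))

  numProperWithWeights-dropEmpty : ∀ {n} (adj : Adj n) ω → Positive ω → ∀ k (β : Fin (suc k) → ℕ) →
    β zero ≡ 0 → numProperWithWeights adj ω (suc k) β ≡ numProperWithWeights adj ω k (β ∘ suc)
  numProperWithWeights-dropEmpty {n} adj ω pos k β β₀≡0 =
    trans (∑-allMaps-avoid-zero n k _ zero-unused)
          (∑-cong (allMaps n k) (λ c → cong bit (cong₂ _∧_ (isProper-relabel adj Fin-suc-injective c)
                                                         (hasClassWeights-suc ω β β₀≡0 c))))
    where
    zero-unused : ∀ c v → lookup c v ≡ zero → bit (isProper adj c ∧ hasClassWeights ω β c) ≡ 0
    zero-unused c v cv≡0 = bit≡0 λ h → <⇒≱ (pos v) (begin
      ω v                          ≤⟨ ≤-classWeight ω c v ⟩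
      classWeight ω c (lookup c v) ≡⟨ cong (classWeight ω c) cv≡0 ⟩
      classWeight ω c zero         ≡⟨ hasClassWeights⇒ ω β c (∧-conicalʳ (isProper adj c) _ h) zero ⟩
      β zero                       ≡⟨ β₀≡0 ⟩
      0                            ∎)
      where open ≤-Reasoning

  numProperWithWeights-wrongTotal : ∀ {n} (adj : Adj n) ω k (β : Fin k → ℕ) →
    ∑Fin k β ≢ totalWeight ω → numProperWithWeights adj ω k β ≡ 0
  numProperWithWeights-wrongTotal {n} adj ω k β ∑β≢N = ∑-zero (allMaps n k) (λ c → bit≡0 λ h →
    ∑β≢N (trans (∑-cong (allFin k) (λ i → sym (hasClassWeights⇒ ω β c (∧-conicalʳ (isProper adj c) _ h) i)))
                (∑-classWeight ω c)))

  ∑-allMaps-exactlyOne : ∀ k B (w : Fin k → ℕ) → (∀ i → w i ≤ B) →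
    ∑ (allMaps k (suc B)) (λ α → bit (allB (λ i → ⌊ w i ≟ toℕ (lookup α i) ⌋))) ≡ 1
  ∑-allMaps-exactlyOne zero    B w w≤B = refl
  ∑-allMaps-exactlyOne (suc k) B w w≤B = begin
    ∑ (allMaps (suc k) (suc B)) (λ α → bit (allB (λ i → ⌊ w i ≟ toℕ (lookup α i) ⌋)))
      ≡⟨ ∑-allMaps-suc k (suc B) (λ α → bit (allB (λ i → ⌊ w i ≟ toℕ (lookup α i) ⌋))) ⟩
    ∑Fin (suc B) (λ a → ∑ (allMaps k (suc B)) (λ α → bit (allB (λ i → ⌊ w i ≟ toℕ (lookup (a ∷ α) i) ⌋))))
      ≡⟨ ∑-cong (allFin (suc B)) (λ a → ∑-cong (allMaps k (suc B)) (λ α →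
           trans (cong bit (allB-suc (λ i → ⌊ w i ≟ toℕ (lookup (a ∷ α) i) ⌋))) (bit-∧ (first a) (rest α)))) ⟩
    ∑Fin (suc B) (λ a → ∑ (allMaps k (suc B)) (λ α → bit (first a) * bit (rest α)))
      ≡⟨ ∑-cong (allFin (suc B)) (λ a → ∑-*ˡ (allMaps k (suc B)) (bit (first a)) (bit ∘ rest)) ⟩
    ∑Fin (suc B) (λ a → bit (first a) * ∑ (allMaps k (suc B)) (bit ∘ rest))
      ≡⟨ ∑-*ʳ (allFin (suc B)) (∑ (allMaps k (suc B)) (bit ∘ rest)) (bit ∘ first) ⟩
    ∑Fin (suc B) (bit ∘ first) * ∑ (allMaps k (suc B)) (bit ∘ rest)
      ≡⟨ cong₂ _*_ (∑Fin-toℕ-point B (w zero) (w≤B zero)) (∑-allMaps-exactlyOne k B (w ∘ suc) (w≤B ∘ suc)) ⟩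
    1 ∎
    where
    open ≡-Reasoning
    first : Fin (suc B) → Bool
    first a = ⌊ w zero ≟ toℕ a ⌋
    rest : Vec (Fin (suc B)) k → Bool
    rest α = allB (λ i → ⌊ w (suc i) ≟ toℕ (lookup α i) ⌋)

  numProper≡∑numProperWithWeights : ∀ {n} (adj : Adj n) ω k B → totalWeight ω ≤ B →
    numProper adj k ≡ ∑ (allMaps k (suc B)) (λ α → numProperWithWeights adj ω k (toℕ ∘ lookup α))
  numProper≡∑numProperWithWeights {n} adj ω k B N≤B = begin
    numProper adj k
      ≡⟨ countTrue-map (isProper adj) (allMaps n k) ⟩
    ∑ (allMaps n k) (λ c → bit (isProper adj c))
      ≡⟨ ∑-cong (allMaps n k) counted-once ⟩
    ∑ (allMaps n k) (λ c → ∑ (allMaps k (suc B)) (λ α → bit (isProper adj c ∧ weights α c)))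
      ≡⟨ ∑-comm (allMaps n k) (allMaps k (suc B)) (λ c α → bit (isProper adj c ∧ weights α c)) ⟩
    ∑ (allMaps k (suc B)) (λ α → numProperWithWeights adj ω k (toℕ ∘ lookup α)) ∎
    where
    open ≡-Reasoning
    weights : Vec (Fin (suc B)) k → Vec (Fin k) n → Bool
    weights α = hasClassWeights ω (toℕ ∘ lookup α)
    classWeight≤B : ∀ c i → classWeight ω c i ≤ B
    classWeight≤B c i = ≤-trans (≤-∑ (allFin k) (classWeight ω c) (∈-allFin i))
                                (≤-trans (≤-reflexive (∑-classWeight ω c)) N≤B)
    counted-once : ∀ c → bit (isProper adj c) ≡ ∑ (allMaps k (suc B)) (λ α → bit (isProper adj c ∧ weights α c))
    counted-once c = sym (begin
      ∑ (allMaps k (suc B)) (λ α → bit (isProper adj c ∧ weights α c))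
        ≡⟨ ∑-cong (allMaps k (suc B)) (λ α → bit-∧ (isProper adj c) (weights α c)) ⟩
      ∑ (allMaps k (suc B)) (λ α → bit (isProper adj c) * bit (weights α c))
        ≡⟨ ∑-*ˡ (allMaps k (suc B)) (bit (isProper adj c)) (λ α → bit (weights α c)) ⟩
      bit (isProper adj c) * ∑ (allMaps k (suc B)) (λ α → bit (weights α c))
        ≡⟨ cong (bit (isProper adj c) *_) (∑-allMaps-exactlyOne k B (classWeight ω c) (classWeight≤B c)) ⟩
      bit (isProper adj c) * 1
        ≡⟨ *-identityʳ (bit (isProper adj c)) ⟩
      bit (isProper adj c) ∎)

module Partitions where

  open import Data.Nat using (ℕ; zero; suc; _+_; _∸_; _≤_; _≤?_; _≟_; z≤n; s≤s; s≤s⁻¹)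
  open import Data.Nat.Properties
  open import Data.Fin using (Fin; zero; suc; cast)
  open import Data.Fin.Properties using (any?; cast-is-id)
  open import Data.Fin.Permutation using (Permutation′; _⟨$⟩ʳ_; transpose; lift₀; _∘ₚ_) renaming (id to idₚ)
  open import Data.List using (List; []; _∷_; map; tabulate; filter; upTo)
  open import Data.List.Properties using (map-tabulate; length-tabulate; lookup-tabulate)
  open import Data.List.Membership.Propositional using (_∈_)
  open import Data.List.Membership.Propositional.Properties
    using (∈-map⁺; ∈-map⁻; ∈-concat⁺′; ∈-concat⁻′; ∈-filter⁺; ∈-filter⁻; ∈-upTo⁺; ∈-upTo⁻)
  open import Data.List.Relation.Unary.Any using (here)
  open import Data.List.Relation.Unary.All using (All; []; _∷_)
  open import Data.Nat.ListAction using () renaming (sum to sumℕ)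
  open import Data.Unit using (⊤; tt)
  open import Data.Sum using (_⊎_; inj₁; inj₂)
  open import Data.Product using (_×_; _,_; proj₁; proj₂; Σ)
  open import Relation.Nullary using (yes; no; contradiction)
  open import Relation.Binary.PropositionalEquality
  open import Function using (_∘_; id)
  open import Defs
  open Counting
  open Colourings

  PositiveDescending : ∀ {k} → (Fin k → ℕ) → Set
  PositiveDescending {zero}  s = ⊤
  PositiveDescending {suc k} s = (1 ≤ s zero) × (∀ i → s (suc i) ≤ s zero) × PositiveDescending (s ∘ suc)

  ZerosThenPositiveDescending : ∀ {k} → (Fin k → ℕ) → Set
  ZerosThenPositiveDescending {zero}  s = ⊤
  ZerosThenPositiveDescending {suc k} s =
    (s zero ≡ 0 × ZerosThenPositiveDescending (s ∘ suc)) ⊎ PositiveDescending s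

  PositiveDescendingBelow : ℕ → List ℕ → Set
  PositiveDescendingBelow b []      = ⊤
  PositiveDescendingBelow b (q ∷ μ) = (1 ≤ q) × (q ≤ b) × PositiveDescendingBelow q μ

  argmax : ∀ {k} (β : Fin (suc k) → ℕ) → Σ (Fin (suc k)) (λ j → ∀ i → β i ≤ β j)
  argmax {zero}  β = zero , λ { zero → ≤-refl }
  argmax {suc k} β with argmax (β ∘ suc)
  ... | j , β≤βj with β (suc j) ≤? β zero
  ... | yes βj≤β₀ = zero    , λ { zero → ≤-refl ; (suc i) → ≤-trans (β≤βj i) βj≤β₀ }
  ... | no  βj≰β₀ = suc j   , λ { zero → <⇒≤ (≰⇒> βj≰β₀) ; (suc i) → β≤βj i }

  zeroOrMaximum : ∀ {k} (β : Fin (suc k) → ℕ) →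
    Σ (Fin (suc k)) (λ j → (β j ≡ 0) ⊎ ((∀ i → β i ≢ 0) × (∀ i → β i ≤ β j)))
  zeroOrMaximum β with any? (λ i → β i ≟ 0)
  ... | yes (i , βi≡0) = i , inj₁ βi≡0
  ... | no  no-zero    = proj₁ (argmax β) , inj₂ ((λ i βi≡0 → no-zero (i , βi≡0)) , proj₂ (argmax β))

  ZerosThen⇒PositiveDescending : ∀ {k} (s : Fin k → ℕ) → ZerosThenPositiveDescending s → (∀ i → s i ≢ 0) →
    PositiveDescending s
  ZerosThen⇒PositiveDescending {zero}  s _               _       = tt
  ZerosThen⇒PositiveDescending {suc k} s (inj₁ (s₀≡0 , _)) nonzero = contradiction s₀≡0 (nonzero zero)
  ZerosThen⇒PositiveDescending {suc k} s (inj₂ desc)      _       = desc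

  selectionSort : ∀ k (β : Fin k → ℕ) → Σ (Permutation′ k) (λ π → ZerosThenPositiveDescending (β ∘ (π ⟨$⟩ʳ_)))
  selectionSort zero    β = idₚ , tt
  selectionSort (suc k) β with zeroOrMaximum β
  ... | j , choice with selectionSort k (λ i → β (transpose zero j ⟨$⟩ʳ suc i))
  ... | π , sorted = lift₀ π ∘ₚ transpose zero j , head choice
    where
    head : (β j ≡ 0) ⊎ ((∀ i → β i ≢ 0) × (∀ i → β i ≤ β j)) →
           ZerosThenPositiveDescending (β ∘ ((lift₀ π ∘ₚ transpose zero j) ⟨$⟩ʳ_))
    head (inj₁ βj≡0)             = inj₁ (βj≡0 , sorted)
    head (inj₂ (nonzero , max)) =
      inj₂ (n≢0⇒n>0 (nonzero j) , (λ _ → max _) , ZerosThen⇒PositiveDescending _ sorted (λ _ → nonzero _))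

  ∈-parts⁺ : ∀ f r b μ → PositiveDescendingBelow b μ → sumℕ μ ≡ r → r ≤ f → μ ∈ parts f r b
  ∈-parts⁺ f zero b [] tt refl _ = here refl
  ∈-parts⁺ f r b (q ∷ μ) (1≤q , q≤b , desc) ∑≡r r≤f with r | f
  ... | zero   | _      = contradiction (≤-trans (m≤m+n q (sumℕ μ)) (≤-reflexive ∑≡r)) (<⇒≱ 1≤q)
  ... | suc r′ | zero   = contradiction r≤f λ ()
  ... | suc r′ | suc f′ =
    ∈-concat⁺′ (∈-map⁺ (q ∷_) μ∈parts) (∈-map⁺ (λ q → map (q ∷_) (parts f′ (suc r′ ∸ q) q)) q∈choices)
    where
    q≤r : q ≤ suc r′
    q≤r = ≤-trans (m≤m+n q (sumℕ μ)) (≤-reflexive ∑≡r)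
    μ∈parts : μ ∈ parts f′ (suc r′ ∸ q) q
    μ∈parts = ∈-parts⁺ f′ (suc r′ ∸ q) q μ desc (trans (sym (m+n∸m≡n q (sumℕ μ))) (cong (_∸ q) ∑≡r))
                       (≤-trans (∸-monoʳ-≤ (suc r′) 1≤q) (s≤s⁻¹ r≤f))
    q∈choices : q ∈ filter (_≤? b) (map suc (upTo (suc r′)))
    q∈choices = ∈-filter⁺ (_≤? b) (∈-suc-upTo q 1≤q q≤r) q≤b
      where
      ∈-suc-upTo : ∀ q → 1 ≤ q → q ≤ suc r′ → q ∈ map suc (upTo (suc r′))
      ∈-suc-upTo (suc q′) _ q≤r = ∈-map⁺ suc (∈-upTo⁺ q≤r)

  ∈-parts⁻ : ∀ f r b μ → μ ∈ parts f r b → All (1 ≤_) μ × (sumℕ μ ≡ r)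
  ∈-parts⁻ f       zero    b .[] (here refl) = [] , refl
  ∈-parts⁻ (suc f) (suc r) b μ   μ∈
    with ∈-concat⁻′ (map (λ q → map (q ∷_) (parts f (suc r ∸ q) q)) (filter (_≤? b) (map suc (upTo (suc r))))) μ∈
  ... | μs , μ∈μs , μs∈ with ∈-map⁻ (λ q → map (q ∷_) (parts f (suc r ∸ q) q)) μs∈
  ... | q , q∈ , refl with ∈-map⁻ (q ∷_) μ∈μs
  ... | μ′ , μ′∈ , refl with ∈-map⁻ suc (proj₁ (∈-filter⁻ (_≤? b) q∈))
  ... | q′ , q′∈ , refl with ∈-parts⁻ f (suc r ∸ suc q′) (suc q′) μ′ μ′∈
  ... | positive , ∑μ′ = (s≤s z≤n ∷ positive) , trans (cong (suc q′ +_) ∑μ′) (m+[n∸m]≡n (∈-upTo⁻ q′∈))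

  ∈-partitions⁻ : ∀ N {λ′} → λ′ ∈ partitions N → All (1 ≤_) λ′ × (sumℕ λ′ ≡ N)
  ∈-partitions⁻ N {λ′} = ∈-parts⁻ N N N λ′

  dropZeros : ∀ k → (Fin k → ℕ) → List ℕ
  dropZeros zero    s = []
  dropZeros (suc k) s with s zero ≟ 0
  ... | yes _ = dropZeros k (s ∘ suc)
  ... | no  _ = tabulate s

  coeffX-tabulate : ∀ {n} (adj : Adj n) ω k (s : Fin k → ℕ) →
    numProperWithWeights adj ω k s ≡ coeffX adj ω (tabulate s)
  coeffX-tabulate adj ω k s =
    trans (numProperWithWeights-cast (sym (length-tabulate s)) λ i → sym (lookup-tabulate s i))
          (sym (coeffX≡numProperWithWeights adj ω (tabulate s)))
    where
    numProperWithWeights-cast : ∀ {k k′} (k≡k′ : k ≡ k′) {s : Fin k → ℕ} {s′ : Fin k′ → ℕ} →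
      (∀ i → s i ≡ s′ (cast k≡k′ i)) → numProperWithWeights adj ω k s ≡ numProperWithWeights adj ω k′ s′
    numProperWithWeights-cast refl {s′ = s′} e =
      numProperWithWeights-cong adj ω _ λ i → trans (e i) (cong s′ (cast-is-id refl i))

  numProperWithWeights-dropZeros : ∀ {n} (adj : Adj n) ω → Positive ω → ∀ k s →
    numProperWithWeights adj ω k s ≡ coeffX adj ω (dropZeros k s)
  numProperWithWeights-dropZeros adj ω pos zero    s = coeffX-tabulate adj ω zero s
  numProperWithWeights-dropZeros adj ω pos (suc k) s with s zero ≟ 0
  ... | yes s₀≡0 = trans (numProperWithWeights-dropEmpty adj ω pos k s s₀≡0)
                         (numProperWithWeights-dropZeros adj ω pos k (s ∘ suc))
  ... | no  _    = coeffX-tabulate adj ω (suc k) s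

  sum-dropZeros : ∀ k s → sumℕ (dropZeros k s) ≡ ∑Fin k s
  sum-dropZeros zero    s = refl
  sum-dropZeros (suc k) s with s zero ≟ 0
  ... | yes s₀≡0 = trans (sum-dropZeros k (s ∘ suc))
                         (sym (trans (∑Fin-suc k s) (cong (_+ ∑Fin k (s ∘ suc)) s₀≡0)))
  ... | no  _    = cong sumℕ (sym (map-tabulate id s))

  PositiveDescending⇒Below : ∀ k (s : Fin (suc k) → ℕ) → PositiveDescending s →
    ∀ b → s zero ≤ b → PositiveDescendingBelow b (tabulate s)
  PositiveDescending⇒Below zero    s (1≤s₀ , _ , _)          b s₀≤b = 1≤s₀ , s₀≤b , tt
  PositiveDescending⇒Below (suc k) s (1≤s₀ , s≤s₀ , desc) b s₀≤b =
    1≤s₀ , s₀≤b , PositiveDescending⇒Below k (s ∘ suc) desc (s zero) (s≤s₀ zero)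

  dropZeros-below : ∀ k s → ZerosThenPositiveDescending s → ∀ b → ∑Fin k s ≤ b →
    PositiveDescendingBelow b (dropZeros k s)
  dropZeros-below zero    s _ b _ = tt
  dropZeros-below (suc k) s sorted b ∑≤b with s zero ≟ 0 | sorted
  ... | yes _     | inj₁ (_ , sorted′) =
    dropZeros-below k (s ∘ suc) sorted′ b (≤-trans (m≤n+m _ (s zero)) (≤-trans (≤-reflexive (sym (∑Fin-suc k s))) ∑≤b))
  ... | yes s₀≡0  | inj₂ (1≤s₀ , _)   = contradiction s₀≡0 (n>0⇒n≢0 1≤s₀)
  ... | no  s₀≢0  | inj₁ (s₀≡0 , _)   = contradiction s₀≡0 s₀≢0
  ... | no  _     | inj₂ desc         =
    PositiveDescending⇒Below k s desc b (≤-trans (m≤m+n (s zero) _) (≤-trans (≤-reflexive (sym (∑Fin-suc k s))) ∑≤b))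

  partitionOf : ∀ k → (Fin k → ℕ) → List ℕ
  partitionOf k β = dropZeros k (β ∘ (proj₁ (selectionSort k β) ⟨$⟩ʳ_))

  numProperWithWeights≡coeffX : ∀ {n} (adj : Adj n) ω → Positive ω → ∀ k β →
    numProperWithWeights adj ω k β ≡ coeffX adj ω (partitionOf k β)
  numProperWithWeights≡coeffX adj ω pos k β =
    trans (numProperWithWeights-permute adj ω k β (proj₁ (selectionSort k β)))
          (numProperWithWeights-dropZeros adj ω pos k _)

  partitionOf∈partitions : ∀ k β N → ∑Fin k β ≡ N → partitionOf k β ∈ partitions N
  partitionOf∈partitions k β N ∑β≡N =
    ∈-parts⁺ N N N (partitionOf k β) (dropZeros-below k sorted (proj₂ (selectionSort k β)) N (≤-reflexive ∑≡N))
             (trans (sum-dropZeros k sorted) ∑≡N) ≤-refl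
    where
    sorted = β ∘ (proj₁ (selectionSort k β) ⟨$⟩ʳ_)
    ∑≡N : ∑Fin k sorted ≡ N
    ∑≡N = trans (sym (∑Fin-permute k β (proj₁ (selectionSort k β)))) ∑β≡N

module PathForests where

  open import Data.Nat using (ℕ; zero; suc; _+_; _*_; _∸_; _^_; _≤_; _≟_; _<?_)
  open import Data.Nat.Properties
  open import Algebra.Properties.CommutativeSemigroup *-commutativeSemigroup using (x∙yz≈y∙xz)
  open import Data.Bool using (Bool; true; false; _∧_; _∨_; not; if_then_else_)
  open import Data.Bool.Properties using (∧-conicalˡ; ∧-conicalʳ)
  open import Data.Fin using (Fin; zero; suc; toℕ)
  open import Data.Fin.Properties using () renaming (_≟_ to _≟ᶠ_)
  open import Data.Vec using (Vec; _∷_)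
  open import Data.List using ([]; _∷_; allFin; length)
  open import Data.List.Relation.Unary.All using (All; []; _∷_)
  open import Data.Nat.ListAction using () renaming (sum to sumℕ)
  open import Relation.Nullary using (yes; no; contradiction)
  open import Relation.Nullary.Decidable using (⌊_⌋; ⌊⌋-map′)
  open import Relation.Binary.PropositionalEquality
  open import Function using (_∘_)
  open import Defs
  open Counting
  open Colourings

  -- pathAdj λ′ is blockPathAdj (blockOf λ′) (sumℕ λ′) by definition.
  blockPathAdj : (ℕ → ℕ) → (n : ℕ) → Adj n
  blockPathAdj b n u v = (⌊ suc (toℕ u) ≟ toℕ v ⌋ ∨ ⌊ suc (toℕ v) ≟ toℕ u ⌋) ∧ ⌊ b (toℕ u) ≟ b (toℕ v) ⌋

  blockPathAdj-suc : ∀ n b (u v : Fin (suc n)) →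
    blockPathAdj b (suc (suc n)) (suc u) (suc v) ≡ blockPathAdj (b ∘ suc) (suc n) u v
  blockPathAdj-suc n b u v = cong₂ (λ x y → (x ∨ y) ∧ ⌊ b (suc (toℕ u)) ≟ b (suc (toℕ v)) ⌋)
                                   (⌊suc≟suc⌋ℕ (suc (toℕ u)) (toℕ v)) (⌊suc≟suc⌋ℕ (suc (toℕ v)) (toℕ u))

  gate : ∀ {k} → Bool → Fin k → Fin k → Bool
  gate linked c₀ c₁ = if linked then not ⌊ c₀ ≟ᶠ c₁ ⌋ else true

  gate⇒ : ∀ {k} linked (c₀ c₁ : Fin k) → gate linked c₀ c₁ ≡ true → linked ≡ true → c₀ ≢ c₁
  gate⇒ true c₀ c₁ h refl c₀≡c₁ with c₀ ≟ᶠ c₁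
  gate⇒ true c₀ c₁ () refl c₀≡c₁ | yes _
  ... | no c₀≢c₁ = c₀≢c₁ c₀≡c₁

  gate⇐ : ∀ {k} linked (c₀ c₁ : Fin k) → (linked ≡ true → c₀ ≢ c₁) → gate linked c₀ c₁ ≡ true
  gate⇐ false c₀ c₁ h = refl
  gate⇐ true  c₀ c₁ h with c₀ ≟ᶠ c₁
  ... | yes c₀≡c₁ = contradiction c₀≡c₁ (h refl)
  ... | no _      = refl

  isProper-blockPath-∷ : ∀ {k} n b (c₀ c₁ : Fin k) (c : Vec (Fin k) n) →
    isProper (blockPathAdj b (suc (suc n))) (c₀ ∷ c₁ ∷ c)
      ≡ (gate ⌊ b 0 ≟ b 1 ⌋ c₀ c₁ ∧ isProper (blockPathAdj (b ∘ suc) (suc n)) (c₁ ∷ c))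
  isProper-blockPath-∷ n b c₀ c₁ c = Bool-ext fwd bwd
    where
    G  = blockPathAdj b (suc (suc n))
    G′ = blockPathAdj (b ∘ suc) (suc n)
    linked = ⌊ b 0 ≟ b 1 ⌋
    fwd : isProper G (c₀ ∷ c₁ ∷ c) ≡ true → (gate linked c₀ c₁ ∧ isProper G′ (c₁ ∷ c)) ≡ true
    fwd h = cong₂ _∧_ (gate⇐ linked c₀ c₁ (proper zero (suc zero)))
                      (isProper⇐ G′ (c₁ ∷ c) λ u v uv → proper (suc u) (suc v) (trans (blockPathAdj-suc n b u v) uv))
      where proper = isProper⇒ G (c₀ ∷ c₁ ∷ c) h
    bwd : (gate linked c₀ c₁ ∧ isProper G′ (c₁ ∷ c)) ≡ true → isProper G (c₀ ∷ c₁ ∷ c) ≡ true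
    bwd h = isProper⇐ G (c₀ ∷ c₁ ∷ c) proper
      where
      first : linked ≡ true → c₀ ≢ c₁
      first = gate⇒ linked c₀ c₁ (∧-conicalˡ _ _ h)
      rest : IsProperColouring G′ (c₁ ∷ c)
      rest = isProper⇒ G′ (c₁ ∷ c) (∧-conicalʳ (gate linked c₀ c₁) _ h)
      proper : IsProperColouring G (c₀ ∷ c₁ ∷ c)
      proper zero          (suc zero)    e = first e
      proper (suc zero)    zero          e = first (⇒⌊⌋≡true (b 0 ≟ b 1) (sym (⌊⌋≡true⇒ (b 1 ≟ b 0) e))) ∘ sym
      proper (suc u)       (suc v)       e = rest u v (trans (sym (blockPathAdj-suc n b u v)) e)
      proper zero          zero          ()
      proper zero          (suc (suc v)) ()
      proper (suc (suc u)) zero          ()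

  choices : ℕ → Bool → ℕ
  choices k linked = if linked then k ∸ 1 else k

  ∑Fin-gate : ∀ k linked (c₁ : Fin k) → ∑Fin k (λ c₀ → bit (gate linked c₀ c₁)) ≡ choices k linked
  ∑Fin-gate k true  c₁ = ∑Fin-≢ k c₁
  ∑Fin-gate k false c₁ = trans (∑Fin-const k 1) (*-identityʳ k)

  numProper-blockPath-∷ : ∀ n b k →
    numProper (blockPathAdj b (suc (suc n))) k ≡ choices k ⌊ b 0 ≟ b 1 ⌋ * numProper (blockPathAdj (b ∘ suc) (suc n)) k
  numProper-blockPath-∷ n b k = begin
    numProper G k
      ≡⟨ countTrue-map (isProper G) (allMaps (suc (suc n)) k) ⟩
    ∑ (allMaps (suc (suc n)) k) (bit ∘ isProper G)
      ≡⟨ ∑-allMaps-suc (suc n) k (bit ∘ isProper G) ⟩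
    ∑Fin k (λ c₀ → ∑ (allMaps (suc n) k) (λ c → bit (isProper G (c₀ ∷ c))))
      ≡⟨ ∑-cong (allFin k) (λ c₀ → ∑-allMaps-suc n k (λ c → bit (isProper G (c₀ ∷ c)))) ⟩
    ∑Fin k (λ c₀ → ∑Fin k (λ c₁ → ∑ (allMaps n k) (λ c → bit (isProper G (c₀ ∷ c₁ ∷ c)))))
      ≡⟨ ∑-cong (allFin k) (λ c₀ → ∑-cong (allFin k) (λ c₁ → split c₀ c₁)) ⟩
    ∑Fin k (λ c₀ → ∑Fin k (λ c₁ → bit (gate linked c₀ c₁) * rest c₁))
      ≡⟨ ∑-comm (allFin k) (allFin k) (λ c₀ c₁ → bit (gate linked c₀ c₁) * rest c₁) ⟩
    ∑Fin k (λ c₁ → ∑Fin k (λ c₀ → bit (gate linked c₀ c₁) * rest c₁))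
      ≡⟨ ∑-cong (allFin k) (λ c₁ → trans (∑-*ʳ (allFin k) (rest c₁) (λ c₀ → bit (gate linked c₀ c₁)))
                                         (cong (_* rest c₁) (∑Fin-gate k linked c₁))) ⟩
    ∑Fin k (λ c₁ → choices k linked * rest c₁)
      ≡⟨ ∑-*ˡ (allFin k) (choices k linked) rest ⟩
    choices k linked * ∑Fin k rest
      ≡⟨ cong (choices k linked *_) (trans (countTrue-map (isProper G′) (allMaps (suc n) k)) (∑-allMaps-suc n k (bit ∘ isProper G′))) ⟨
    choices k linked * numProper G′ k ∎
    where
    open ≡-Reasoning
    G  = blockPathAdj b (suc (suc n))
    G′ = blockPathAdj (b ∘ suc) (suc n)
    linked = ⌊ b 0 ≟ b 1 ⌋
    rest : Fin k → ℕ
    rest c₁ = ∑ (allMaps n k) (λ c → bit (isProper G′ (c₁ ∷ c)))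
    split : ∀ c₀ c₁ → ∑ (allMaps n k) (λ c → bit (isProper G (c₀ ∷ c₁ ∷ c))) ≡ bit (gate linked c₀ c₁) * rest c₁
    split c₀ c₁ = trans (∑-cong (allMaps n k) (λ c → trans (cong bit (isProper-blockPath-∷ n b c₀ c₁ c))
                                                             (bit-∧ (gate linked c₀ c₁) (isProper G′ (c₁ ∷ c)))))
                        (∑-*ˡ (allMaps n k) (bit (gate linked c₀ c₁)) (λ c → bit (isProper G′ (c₁ ∷ c))))

  ∏choices : ℕ → (ℕ → ℕ) → ℕ → ℕ
  ∏choices k b zero    = 1
  ∏choices k b (suc n) = choices k ⌊ b 0 ≟ b 1 ⌋ * ∏choices k (b ∘ suc) n

  numProper-blockPath : ∀ n b k → numProper (blockPathAdj b (suc n)) k ≡ k * ∏choices k b n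
  numProper-blockPath zero    b k = trans (countTrue-map _ (allMaps 1 k)) (trans (∑-allMaps-suc 0 k _) (∑Fin-const k 1))
  numProper-blockPath (suc n) b k =
    trans (numProper-blockPath-∷ n b k)
          (trans (cong (choices k ⌊ b 0 ≟ b 1 ⌋ *_) (numProper-blockPath n (b ∘ suc) k))
                 (x∙yz≈y∙xz (choices k ⌊ b 0 ≟ b 1 ⌋) k (∏choices k (b ∘ suc) n)))

  ∏choices-cong : ∀ k (b b′ : ℕ → ℕ) n → (∀ i → ⌊ b i ≟ b (suc i) ⌋ ≡ ⌊ b′ i ≟ b′ (suc i) ⌋) →
    ∏choices k b n ≡ ∏choices k b′ n
  ∏choices-cong k b b′ zero    e = refl
  ∏choices-cong k b b′ (suc n) e =
    cong₂ (λ linked r → choices k linked * r) (e 0) (∏choices-cong k (b ∘ suc) (b′ ∘ suc) n (e ∘ suc))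

  ∏choices-firstBlock : ∀ k p ps →
    ∏choices k (blockOf (suc p ∷ ps)) (p + sumℕ ps) ≡ (k ∸ 1) ^ p * ∏choices k (blockOf (1 ∷ ps)) (sumℕ ps)
  ∏choices-firstBlock k zero    ps = sym (+-identityʳ _)
  ∏choices-firstBlock k (suc p) ps =
    trans (cong ((k ∸ 1) *_) (trans (∏choices-cong k _ _ (p + sumℕ ps) shift) (∏choices-firstBlock k p ps)))
          (sym (*-assoc (k ∸ 1) ((k ∸ 1) ^ p) _))
    where
    ⌊suc<?suc⌋ : ∀ i q → ⌊ suc i <? suc q ⌋ ≡ ⌊ i <? q ⌋
    ⌊suc<?suc⌋ i q = trans (⌊⌋-map′ _ _ _) (sym (⌊⌋-map′ _ _ _))
    blockOf-suc : ∀ i → blockOf (suc (suc p) ∷ ps) (suc i) ≡ blockOf (suc p ∷ ps) i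
    blockOf-suc i = cong (λ t → if t then 0 else suc (blockOf ps (i ∸ suc p))) (⌊suc<?suc⌋ i (suc p))
    shift : ∀ i → ⌊ blockOf (suc (suc p) ∷ ps) (suc i) ≟ blockOf (suc (suc p) ∷ ps) (suc (suc i)) ⌋
                ≡ ⌊ blockOf (suc p ∷ ps) i ≟ blockOf (suc p ∷ ps) (suc i) ⌋
    shift i = cong₂ (λ x y → ⌊ x ≟ y ⌋) (blockOf-suc i) (blockOf-suc (suc i))

  length≤sum : ∀ ps → All (1 ≤_) ps → length ps ≤ sumℕ ps
  length≤sum []       []         = ≤-refl
  length≤sum (p ∷ ps) (1≤p ∷ pos) = +-mono-≤ 1≤p (length≤sum ps pos)

  regroup : ∀ a b p m r → a * (b ^ p * (a ^ m * b ^ r)) ≡ a ^ suc m * b ^ (p + r)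
  regroup a b p m r = begin
    a * (b ^ p * (a ^ m * b ^ r)) ≡⟨ cong (a *_) (x∙yz≈y∙xz (b ^ p) (a ^ m) (b ^ r)) ⟩
    a * (a ^ m * (b ^ p * b ^ r)) ≡⟨ *-assoc a (a ^ m) _ ⟨
    a ^ suc m * (b ^ p * b ^ r)   ≡⟨ cong (a ^ suc m *_) (^-distribˡ-+-* b p r) ⟨
    a ^ suc m * b ^ (p + r)       ∎
    where open ≡-Reasoning

  mutual
    ∏choices-block : ∀ k p ps → All (1 ≤_) ps →
      k * ∏choices k (blockOf (suc p ∷ ps)) (p + sumℕ ps) ≡ k ^ suc (length ps) * (k ∸ 1) ^ (p + sumℕ ps ∸ length ps)
    ∏choices-block k p ps pos = begin
      k * ∏choices k (blockOf (suc p ∷ ps)) (p + sumℕ ps)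
        ≡⟨ cong (k *_) (∏choices-firstBlock k p ps) ⟩
      k * ((k ∸ 1) ^ p * ∏choices k (blockOf (1 ∷ ps)) (sumℕ ps))
        ≡⟨ cong (λ t → k * ((k ∸ 1) ^ p * t)) (∏choices-afterBlock k ps pos) ⟩
      k * ((k ∸ 1) ^ p * (k ^ length ps * (k ∸ 1) ^ (sumℕ ps ∸ length ps)))
        ≡⟨ regroup k (k ∸ 1) p (length ps) (sumℕ ps ∸ length ps) ⟩
      k ^ suc (length ps) * (k ∸ 1) ^ (p + (sumℕ ps ∸ length ps))
        ≡⟨ cong (λ e → k ^ suc (length ps) * (k ∸ 1) ^ e) (+-∸-assoc p (length≤sum ps pos)) ⟨
      k ^ suc (length ps) * (k ∸ 1) ^ (p + sumℕ ps ∸ length ps) ∎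
      where open ≡-Reasoning

    ∏choices-afterBlock : ∀ k ps → All (1 ≤_) ps →
      ∏choices k (blockOf (1 ∷ ps)) (sumℕ ps) ≡ k ^ length ps * (k ∸ 1) ^ (sumℕ ps ∸ length ps)
    ∏choices-afterBlock k []           []        = refl
    ∏choices-afterBlock k (suc q ∷ qs) (_ ∷ pos) =
      trans (cong (k *_) (∏choices-cong k _ _ (q + sumℕ qs) (λ i → ⌊suc≟suc⌋ℕ _ _)))
            (∏choices-block k q qs pos)

  numProper-pathAdj : ∀ λ′ → All (1 ≤_) λ′ → ∀ k →
    numProper (pathAdj λ′) k ≡ k ^ length λ′ * (k ∸ 1) ^ (sumℕ λ′ ∸ length λ′)
  numProper-pathAdj []           []        k = refl
  numProper-pathAdj (suc p ∷ ps) (_ ∷ pos) k =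
    trans (numProper-blockPath (p + sumℕ ps) (blockOf (suc p ∷ ps)) k) (∏choices-block k p ps pos)

module Rationals where

  open import Data.Nat as ℕ using (ℕ; zero; suc)
  import Data.Integer as ℤ
  import Data.Integer.Properties as ℤ
  open import Data.Nat.Coprimality as Coprime using ()
  open import Data.Rational using (ℚ; 0ℚ; 1ℚ; mkℚ; _+_; _*_; _-_; 1/_; ≢-nonZero)
  open import Data.Rational.Properties
  open import Data.Rational.Solver using (module +-*-Solver)
  open +-*-Solver
  open import Data.List using (List; []; _∷_; map)
  open import Data.List.Membership.Propositional using (_∈_)
  open import Data.List.Relation.Unary.Any using (here; there)
  open import Relation.Binary.PropositionalEquality
  open import Defs
  open Counting using (∑)

  fromℕℚ-suc : ∀ k → fromℕℚ (suc k) ≡ 1ℚ + fromℕℚ k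
  fromℕℚ-suc k = begin
    fromℕℚ (suc k) ≡⟨ cong (λ z → (ℤ.+ 1 ℤ.+ z) Data.Rational./ 1) (ℤ.*-identityʳ (ℤ.+ k)) ⟨
    1ℚ + k/1       ≡⟨ cong (1ℚ +_) (↥p/↧p≡p k/1) ⟨
    1ℚ + fromℕℚ k  ∎
    where
    open ≡-Reasoning
    k/1 = mkℚ (ℤ.+ k) 0 (Coprime.sym (Coprime.1-coprimeTo k))

  fromℕℚ-suc≢0 : ∀ k → fromℕℚ (suc k) ≢ 0ℚ
  fromℕℚ-suc≢0 k eq with trans (sym (↥p/↧p≡p (mkℚ (ℤ.+ suc k) 0 (Coprime.sym (Coprime.1-coprimeTo (suc k)))))) eq
  ... | ()

  fromℕℚ-+ : ∀ m n → fromℕℚ (m ℕ.+ n) ≡ fromℕℚ m + fromℕℚ n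
  fromℕℚ-+ zero    n = sym (+-identityˡ (fromℕℚ n))
  fromℕℚ-+ (suc m) n = begin
    fromℕℚ (suc (m ℕ.+ n))         ≡⟨ fromℕℚ-suc (m ℕ.+ n) ⟩
    1ℚ + fromℕℚ (m ℕ.+ n)          ≡⟨ cong (1ℚ +_) (fromℕℚ-+ m n) ⟩
    1ℚ + (fromℕℚ m + fromℕℚ n)     ≡⟨ +-assoc 1ℚ (fromℕℚ m) (fromℕℚ n) ⟨
    (1ℚ + fromℕℚ m) + fromℕℚ n     ≡⟨ cong (_+ fromℕℚ n) (fromℕℚ-suc m) ⟨
    fromℕℚ (suc m) + fromℕℚ n      ∎
    where open ≡-Reasoning

  fromℕℚ-* : ∀ m n → fromℕℚ (m ℕ.* n) ≡ fromℕℚ m * fromℕℚ n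
  fromℕℚ-* zero    n = sym (*-zeroˡ (fromℕℚ n))
  fromℕℚ-* (suc m) n = begin
    fromℕℚ (n ℕ.+ m ℕ.* n)          ≡⟨ fromℕℚ-+ n (m ℕ.* n) ⟩
    fromℕℚ n + fromℕℚ (m ℕ.* n)     ≡⟨ cong (fromℕℚ n +_) (fromℕℚ-* m n) ⟩
    fromℕℚ n + fromℕℚ m * fromℕℚ n  ≡⟨ solve 2 (λ x y → y :+ x :* y := (con 1ℚ :+ x) :* y) refl (fromℕℚ m) (fromℕℚ n) ⟩
    (1ℚ + fromℕℚ m) * fromℕℚ n      ≡⟨ cong (_* fromℕℚ n) (fromℕℚ-suc m) ⟨
    fromℕℚ (suc m) * fromℕℚ n       ∎
    where open ≡-Reasoning

  fromℕℚ-^ : ∀ m n → fromℕℚ (m ℕ.^ n) ≡ fromℕℚ m ^ℚ n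
  fromℕℚ-^ m zero    = refl
  fromℕℚ-^ m (suc n) = trans (fromℕℚ-* m (m ℕ.^ n)) (cong (fromℕℚ m *_) (fromℕℚ-^ m n))

  ^ℚ-+ : ∀ x m n → x ^ℚ (m ℕ.+ n) ≡ x ^ℚ m * x ^ℚ n
  ^ℚ-+ x zero    n = sym (*-identityˡ _)
  ^ℚ-+ x (suc m) n = trans (cong (x *_) (^ℚ-+ x m n)) (sym (*-assoc x (x ^ℚ m) (x ^ℚ n)))

  *-^ℚ : ∀ x y n → (x * y) ^ℚ n ≡ x ^ℚ n * y ^ℚ n
  *-^ℚ x y zero    = refl
  *-^ℚ x y (suc n) = trans (cong ((x * y) *_) (*-^ℚ x y n))
    (solve 4 (λ x y a b → (x :* y) :* (a :* b) := (x :* a) :* (y :* b)) refl x y (x ^ℚ n) (y ^ℚ n))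

  1^ℚ : ∀ n → 1ℚ ^ℚ n ≡ 1ℚ
  1^ℚ zero    = refl
  1^ℚ (suc n) = trans (*-identityˡ _) (1^ℚ n)

  *-cancelˡ : ∀ p {q r} → p ≢ 0ℚ → p * q ≡ p * r → q ≡ r
  *-cancelˡ p {q} {r} p≢0 pq≡pr = begin
    q                ≡⟨ 1/p*[p*x]≡x q ⟨
    1/ p * (p * q)   ≡⟨ cong (1/ p *_) pq≡pr ⟩
    1/ p * (p * r)   ≡⟨ 1/p*[p*x]≡x r ⟩
    r                ∎
    where
    open ≡-Reasoning
    instance _ = ≢-nonZero p≢0
    1/p*[p*x]≡x : ∀ x → 1/ p * (p * x) ≡ x
    1/p*[p*x]≡x x = trans (sym (*-assoc (1/ p) p x)) (trans (cong (_* x) (*-inverseˡ p)) (*-identityˡ x))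

  *-divℚ : ∀ w d (d≢0 : d ≢ 0ℚ) → d * divℚ w d d≢0 ≡ w
  *-divℚ w d d≢0 = begin
    d * (w * 1/ d)     ≡⟨ solve 3 (λ d w u → d :* (w :* u) := (u :* d) :* w) refl d w (1/ d) ⟩
    (1/ d * d) * w     ≡⟨ cong (_* w) (*-inverseˡ d) ⟩
    1ℚ * w             ≡⟨ *-identityˡ w ⟩
    w                  ∎
    where
    open ≡-Reasoning
    instance _ = ≢-nonZero d≢0

  divℚ-unique : ∀ w d z (d≢0 : d ≢ 0ℚ) → d * z ≡ w → divℚ w d d≢0 ≡ z
  divℚ-unique w d z d≢0 dz≡w = *-cancelˡ d d≢0 (trans (*-divℚ w d d≢0) (sym dz≡w))

  sumℚ-cong : {A : Set} (L : List A) {f g : A → ℚ} → (∀ x → x ∈ L → f x ≡ g x) → sumℚ (map f L) ≡ sumℚ (map g L)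
  sumℚ-cong []      e = refl
  sumℚ-cong (x ∷ L) e = cong₂ _+_ (e x (here refl)) (sumℚ-cong L (λ y y∈L → e y (there y∈L)))

  sumℚ-zero : {A : Set} (L : List A) {f : A → ℚ} → (∀ x → x ∈ L → f x ≡ 0ℚ) → sumℚ (map f L) ≡ 0ℚ
  sumℚ-zero []      e = refl
  sumℚ-zero (x ∷ L) e = trans (cong₂ _+_ (e x (here refl)) (sumℚ-zero L (λ y y∈L → e y (there y∈L)))) (+-identityˡ 0ℚ)

  sumℚ-*ˡ : {A : Set} (L : List A) (c : ℚ) (f : A → ℚ) → sumℚ (map (λ x → c * f x) L) ≡ c * sumℚ (map f L)
  sumℚ-*ˡ []      c f = sym (*-zeroʳ c)
  sumℚ-*ˡ (x ∷ L) c f = trans (cong (c * f x +_) (sumℚ-*ˡ L c f)) (sym (*-distribˡ-+ c (f x) _))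

  sumℚ-+ : {A : Set} (L : List A) (f g : A → ℚ) → sumℚ (map (λ x → f x + g x) L) ≡ sumℚ (map f L) + sumℚ (map g L)
  sumℚ-+ []      f g = refl
  sumℚ-+ (x ∷ L) f g = trans (cong (f x + g x +_) (sumℚ-+ L f g))
    (solve 4 (λ a b c d → (a :+ b) :+ (c :+ d) := (a :+ c) :+ (b :+ d)) refl (f x) (g x) (sumℚ (map f L)) (sumℚ (map g L)))

  sumℚ-comm : {A B : Set} (L : List A) (M : List B) (f : A → B → ℚ) →
    sumℚ (map (λ x → sumℚ (map (f x) M)) L) ≡ sumℚ (map (λ y → sumℚ (map (λ x → f x y) L)) M)
  sumℚ-comm []      M f = sym (sumℚ-zero M (λ _ _ → refl))
  sumℚ-comm (x ∷ L) M f =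
    trans (cong (sumℚ (map (f x) M) +_) (sumℚ-comm L M f)) (sym (sumℚ-+ M (f x) (λ y → sumℚ (map (λ x → f x y) L))))

  fromℕℚ-∑ : {A : Set} (L : List A) (f : A → ℕ) → fromℕℚ (∑ L f) ≡ sumℚ (map (λ x → fromℕℚ (f x)) L)
  fromℕℚ-∑ []      f = refl
  fromℕℚ-∑ (x ∷ L) f = trans (fromℕℚ-+ (f x) (∑ L f)) (cong (fromℕℚ (f x) +_) (fromℕℚ-∑ L f))


  x/[x-1]-involution : ∀ N (g t : ℚ → ℚ) →
    (∀ y (y≢1 : y - 1ℚ ≢ 0ℚ) → g y ≡ (y - 1ℚ) ^ℚ N * t (divℚ y (y - 1ℚ) y≢1)) →
    ∀ x (x≢1 : x - 1ℚ ≢ 0ℚ) → t x ≡ (x - 1ℚ) ^ℚ N * g (divℚ x (x - 1ℚ) x≢1)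
  x/[x-1]-involution N g t g≡t x x≢1 = begin
    t x                                             ≡⟨ *-identityˡ (t x) ⟨
    1ℚ * t x                                        ≡⟨ cong (_* t x) (trans (cong (_^ℚ N) [x-1][y-1]≡1) (1^ℚ N)) ⟨
    ((x - 1ℚ) * (y - 1ℚ)) ^ℚ N * t x                ≡⟨ cong (_* t x) product^N ⟩
    (x - 1ℚ) ^ℚ N * (y - 1ℚ) ^ℚ N * t x             ≡⟨ *-assoc ((x - 1ℚ) ^ℚ N) ((y - 1ℚ) ^ℚ N) (t x) ⟩
    (x - 1ℚ) ^ℚ N * ((y - 1ℚ) ^ℚ N * t x)           ≡⟨ cong (λ z → (x - 1ℚ) ^ℚ N * ((y - 1ℚ) ^ℚ N * t z)) y/[y-1]≡x ⟨
    (x - 1ℚ) ^ℚ N * ((y - 1ℚ) ^ℚ N * t (divℚ y (y - 1ℚ) y≢1)) ≡⟨ cong ((x - 1ℚ) ^ℚ N *_) (g≡t y y≢1) ⟨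
    (x - 1ℚ) ^ℚ N * g y                             ∎
    where
    open ≡-Reasoning
    y = divℚ x (x - 1ℚ) x≢1
    product^N : ((x - 1ℚ) * (y - 1ℚ)) ^ℚ N ≡ (x - 1ℚ) ^ℚ N * (y - 1ℚ) ^ℚ N
    product^N = *-^ℚ (x - 1ℚ) (y - 1ℚ) N
    instance _ = ≢-nonZero x≢1
    u = 1/ (x - 1ℚ)
    [x-1]u≡1 : (x - 1ℚ) * u ≡ 1ℚ
    [x-1]u≡1 = *-inverseʳ (x - 1ℚ)
    y-1≡u : y - 1ℚ ≡ u
    y-1≡u = begin
      x * u - 1ℚ                ≡⟨ cong (λ t → x * u - t) [x-1]u≡1 ⟨
      x * u - (x - 1ℚ) * u      ≡⟨ solve 2 (λ x u → x :* u :- (x :- con 1ℚ) :* u := u) refl x u ⟩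
      u                         ∎
    [x-1][y-1]≡1 : (x - 1ℚ) * (y - 1ℚ) ≡ 1ℚ
    [x-1][y-1]≡1 = trans (cong ((x - 1ℚ) *_) y-1≡u) [x-1]u≡1
    y≢1 : y - 1ℚ ≢ 0ℚ
    y≢1 y-1≡0 = 1≢0 (trans (sym [x-1][y-1]≡1) (trans (cong ((x - 1ℚ) *_) y-1≡0) (*-zeroʳ (x - 1ℚ))))
    y/[y-1]≡x : divℚ y (y - 1ℚ) y≢1 ≡ x
    y/[y-1]≡x = divℚ-unique y (y - 1ℚ) x y≢1 (trans (cong (_* x) y-1≡u) (*-comm u x))

module Polynomials where

  open import Data.Nat as ℕ using (ℕ; zero; suc)
  open import Data.Rational using (ℚ; 0ℚ; 1ℚ; _+_; _*_; _-_; -_)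
  open import Data.Rational.Properties
  open import Data.Rational.Solver using (module +-*-Solver)
  open +-*-Solver
  open import Data.List using (List; []; _∷_; map; length)
  open import Data.Product using (Σ; _,_; proj₁; proj₂)
  open import Relation.Binary.PropositionalEquality
  open import Defs
  open Rationals

  _+ᴾ_ : List ℚ → List ℚ → List ℚ
  []      +ᴾ q       = q
  (a ∷ p) +ᴾ []      = a ∷ p
  (a ∷ p) +ᴾ (b ∷ q) = (a + b) ∷ (p +ᴾ q)

  evalPoly-+ : ∀ p q x → evalPoly (p +ᴾ q) x ≡ evalPoly p x + evalPoly q x
  evalPoly-+ []      q       x = sym (+-identityˡ _)
  evalPoly-+ (a ∷ p) []      x = sym (+-identityʳ _)
  evalPoly-+ (a ∷ p) (b ∷ q) x = trans (cong (λ t → (a + b) + x * t) (evalPoly-+ p q x))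
    (solve 5 (λ a b x P Q → (a :+ b) :+ x :* (P :+ Q) := (a :+ x :* P) :+ (b :+ x :* Q)) refl a b x (evalPoly p x) (evalPoly q x))

  _·ᴾ_ : ℚ → List ℚ → List ℚ
  c ·ᴾ p = map (c *_) p

  evalPoly-· : ∀ c p x → evalPoly (c ·ᴾ p) x ≡ c * evalPoly p x
  evalPoly-· c []      x = sym (*-zeroʳ c)
  evalPoly-· c (a ∷ p) x = trans (cong (λ t → c * a + x * t) (evalPoly-· c p x))
    (solve 4 (λ c a x P → c :* a :+ x :* (c :* P) := c :* (a :+ x :* P)) refl c a x (evalPoly p x))

  _*ᴾ_ : List ℚ → List ℚ → List ℚ
  []      *ᴾ q = []
  (a ∷ p) *ᴾ q = (a ·ᴾ q) +ᴾ (0ℚ ∷ (p *ᴾ q))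

  evalPoly-* : ∀ p q x → evalPoly (p *ᴾ q) x ≡ evalPoly p x * evalPoly q x
  evalPoly-* []      q x = sym (*-zeroˡ (evalPoly q x))
  evalPoly-* (a ∷ p) q x = begin
    evalPoly ((a ·ᴾ q) +ᴾ (0ℚ ∷ (p *ᴾ q))) x           ≡⟨ evalPoly-+ (a ·ᴾ q) (0ℚ ∷ (p *ᴾ q)) x ⟩
    evalPoly (a ·ᴾ q) x + (0ℚ + x * evalPoly (p *ᴾ q) x) ≡⟨ cong₂ (λ s t → s + (0ℚ + x * t)) (evalPoly-· a q x) (evalPoly-* p q x) ⟩
    a * Q + (0ℚ + x * (evalPoly p x * Q))               ≡⟨ solve 4 (λ a x P Q → a :* Q :+ (con 0ℚ :+ x :* (P :* Q)) := (a :+ x :* P) :* Q) refl a x (evalPoly p x) Q ⟩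
    (a + x * evalPoly p x) * Q                          ∎
    where
    open ≡-Reasoning
    Q = evalPoly q x

  IsPolynomial : (ℚ → ℚ) → Set
  IsPolynomial f = Σ (List ℚ) (λ p → ∀ x → f x ≡ evalPoly p x)

  const-isPolynomial : ∀ c → IsPolynomial (λ _ → c)
  const-isPolynomial c = (c ∷ []) , λ x → solve 2 (λ c x → c := c :+ x :* con 0ℚ) refl c x

  id-isPolynomial : IsPolynomial (λ x → x)
  id-isPolynomial = (0ℚ ∷ 1ℚ ∷ []) , λ x → solve 1 (λ x → x := con 0ℚ :+ x :* (con 1ℚ :+ x :* con 0ℚ)) refl x

  +-isPolynomial : ∀ {f g} → IsPolynomial f → IsPolynomial g → IsPolynomial (λ x → f x + g x)
  +-isPolynomial (p , f≡p) (q , g≡q) = (p +ᴾ q) , λ x → trans (cong₂ _+_ (f≡p x) (g≡q x)) (sym (evalPoly-+ p q x))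

  *-isPolynomial : ∀ {f g} → IsPolynomial f → IsPolynomial g → IsPolynomial (λ x → f x * g x)
  *-isPolynomial (p , f≡p) (q , g≡q) = (p *ᴾ q) , λ x → trans (cong₂ _*_ (f≡p x) (g≡q x)) (sym (evalPoly-* p q x))

  ^-isPolynomial : ∀ {f} → IsPolynomial f → ∀ n → IsPolynomial (λ x → f x ^ℚ n)
  ^-isPolynomial f-poly zero    = const-isPolynomial 1ℚ
  ^-isPolynomial f-poly (suc n) = *-isPolynomial f-poly (^-isPolynomial f-poly n)

  sum-isPolynomial : {A : Set} (L : List A) (F : A → ℚ → ℚ) → (∀ y → IsPolynomial (F y)) →
    IsPolynomial (λ x → sumℚ (map (λ y → F y x) L))
  sum-isPolynomial []      F F-poly = const-isPolynomial 0ℚ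
  sum-isPolynomial (y ∷ L) F F-poly = +-isPolynomial (F-poly y) (sum-isPolynomial L F F-poly)

  neg-isPolynomial : ∀ {f} → IsPolynomial f → IsPolynomial (λ x → - f x)
  neg-isPolynomial (p , f≡p) = ((- 1ℚ) ·ᴾ p) , λ x →
    trans (cong -_ (f≡p x))
          (trans (solve 1 (λ t → :- t := con (- 1ℚ) :* t) refl (evalPoly p x)) (sym (evalPoly-· (- 1ℚ) p x)))

  syntheticQuotient : ℚ → List ℚ → List ℚ
  syntheticQuotient r []       = []
  syntheticQuotient r (d ∷ ds) = evalPoly (d ∷ ds) r ∷ syntheticQuotient r ds

  length-syntheticQuotient : ∀ r cs → length (syntheticQuotient r cs) ≡ length cs
  length-syntheticQuotient r []       = refl
  length-syntheticQuotient r (d ∷ ds) = cong suc (length-syntheticQuotient r ds)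

  evalPoly-factor : ∀ c cs x r → evalPoly (c ∷ cs) x ≡ evalPoly (c ∷ cs) r + (x - r) * evalPoly (syntheticQuotient r cs) x
  evalPoly-factor c []       x r = solve 3 (λ c x r → c :+ x :* con 0ℚ := (c :+ r :* con 0ℚ) :+ (x :- r) :* con 0ℚ) refl c x r
  evalPoly-factor c (d ∷ ds) x r = trans (cong (λ t → c + x * t) (evalPoly-factor d ds x r))
    (solve 6 (λ c x r E D Q → c :+ x :* (E :+ (x :- r) :* Q) := (c :+ r :* E) :+ (x :- r) :* (E :+ x :* Q))
           refl c x r (evalPoly (d ∷ ds) r) d (evalPoly (syntheticQuotient r ds) x))

  syntheticQuotient-root : ∀ c cs r y → evalPoly (c ∷ cs) r ≡ 0ℚ → evalPoly (c ∷ cs) y ≡ 0ℚ → y - r ≢ 0ℚ →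
    evalPoly (syntheticQuotient r cs) y ≡ 0ℚ
  syntheticQuotient-root c cs r y p[r]≡0 p[y]≡0 y-r≢0 = *-cancelˡ (y - r) y-r≢0 (begin
    (y - r) * q[y]                          ≡⟨ +-identityˡ _ ⟨
    0ℚ + (y - r) * q[y]                     ≡⟨ cong (_+ (y - r) * q[y]) p[r]≡0 ⟨
    evalPoly (c ∷ cs) r + (y - r) * q[y]    ≡⟨ evalPoly-factor c cs y r ⟨
    evalPoly (c ∷ cs) y                     ≡⟨ p[y]≡0 ⟩
    0ℚ                                      ≡⟨ *-zeroʳ (y - r) ⟨
    (y - r) * 0ℚ                            ∎)
    where
    open ≡-Reasoning
    q[y] = evalPoly (syntheticQuotient r cs) y

  evalPoly-vanishing : ∀ m p → length p ≡ m → ∀ r → (∀ k → evalPoly p (r + fromℕℚ k) ≡ 0ℚ) →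
    ∀ x → evalPoly p x ≡ 0ℚ
  evalPoly-vanishing _       []       _   r _     x = refl
  evalPoly-vanishing (suc m) (c ∷ cs) len r roots x = begin
    evalPoly (c ∷ cs) x                            ≡⟨ evalPoly-factor c cs x r ⟩
    evalPoly (c ∷ cs) r + (x - r) * evalPoly q x   ≡⟨ cong₂ (λ s t → s + (x - r) * t) p[r]≡0 (q-roots x) ⟩
    0ℚ + (x - r) * 0ℚ                              ≡⟨ solve 1 (λ y → con 0ℚ :+ y :* con 0ℚ := con 0ℚ) refl (x - r) ⟩
    0ℚ                                             ∎
    where
    open ≡-Reasoning
    q = syntheticQuotient r cs
    p[r]≡0 : evalPoly (c ∷ cs) r ≡ 0ℚ
    p[r]≡0 = trans (cong (evalPoly (c ∷ cs)) (sym (+-identityʳ r))) (roots 0)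
    shifted-root : ∀ k → evalPoly q ((r + 1ℚ) + fromℕℚ k) ≡ 0ℚ
    shifted-root k = subst (λ y → evalPoly q y ≡ 0ℚ) r+[k+1]≡[r+1]+k
      (syntheticQuotient-root c cs r (r + fromℕℚ (suc k)) p[r]≡0 (roots (suc k))
        (λ eq → fromℕℚ-suc≢0 k (trans (solve 2 (λ r s → s := (r :+ s) :- r) refl r (fromℕℚ (suc k))) eq)))
      where
      r+[k+1]≡[r+1]+k : r + fromℕℚ (suc k) ≡ (r + 1ℚ) + fromℕℚ k
      r+[k+1]≡[r+1]+k = trans (cong (r +_) (fromℕℚ-suc k)) (sym (+-assoc r 1ℚ (fromℕℚ k)))
    q-roots : ∀ y → evalPoly q y ≡ 0ℚ
    q-roots = evalPoly-vanishing m q (trans (length-syntheticQuotient r cs) (cong ℕ.pred len)) (r + 1ℚ) shifted-root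

  polynomials-agree-on-ℕ⁺ : ∀ {f g} → IsPolynomial f → IsPolynomial g →
    (∀ k → f (fromℕℚ (suc k)) ≡ g (fromℕℚ (suc k))) → ∀ x → f x ≡ g x
  polynomials-agree-on-ℕ⁺ {f} {g} f-poly g-poly agree x = begin
    f x                  ≡⟨ solve 2 (λ a b → a := (a :- b) :+ b) refl (f x) (g x) ⟩
    (f x - g x) + g x    ≡⟨ cong (_+ g x) (trans (f-g≡p x) (evalPoly-vanishing _ p refl 1ℚ p-roots x)) ⟩
    0ℚ + g x             ≡⟨ +-identityˡ (g x) ⟩
    g x                  ∎
    where
    open ≡-Reasoning
    diff = +-isPolynomial f-poly (neg-isPolynomial g-poly)
    p = proj₁ diff
    f-g≡p = proj₂ diff
    p-roots : ∀ k → evalPoly p (1ℚ + fromℕℚ k) ≡ 0ℚ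
    p-roots k = begin
      evalPoly p (1ℚ + fromℕℚ k)                                ≡⟨ f-g≡p _ ⟨
      f (1ℚ + fromℕℚ k) - g (1ℚ + fromℕℚ k)                     ≡⟨ cong (λ y → f y - g y) (fromℕℚ-suc k) ⟨
      f (fromℕℚ (suc k)) - g (fromℕℚ (suc k))                   ≡⟨ cong (_- g (fromℕℚ (suc k))) (agree k) ⟩
      g (fromℕℚ (suc k)) - g (fromℕℚ (suc k))                   ≡⟨ +-inverseʳ (g (fromℕℚ (suc k))) ⟩
      0ℚ                                                        ∎


module PathExpansion where

  open import Data.Nat as ℕ using (ℕ; suc; _≤_; _∸_; _≟_)
  open import Data.Nat.Properties using (≤-refl; ≤-reflexive; ≤-trans; m+[n∸m]≡n)
  open import Data.Fin using (Fin; toℕ)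
  open import Data.Vec using (lookup)
  open import Data.List using (List; map; allFin; length)
  open import Data.List.Properties using (length-tabulate)
  open import Data.List.Membership.Propositional using (_∈_)
  open import Data.Nat.ListAction using () renaming (sum to sumℕ)
  open import Data.Rational using (ℚ; 0ℚ; 1ℚ; _*_; _-_; -_)
  open import Data.Rational.Properties using (*-zeroʳ)
  open import Data.Rational.Solver using (module +-*-Solver)
  open +-*-Solver
  open import Data.Product using (_,_; proj₁; proj₂)
  open import Relation.Nullary using (Dec; yes; no)
  open import Relation.Binary.PropositionalEquality
  open import Defs
  open Counting
  open Colourings
  open Partitions
  open PathForests
  open Rationals
  open Polynomials

  ones : ∀ {m} → Fin m → ℕ
  ones _ = 1

  totalWeight-ones : ∀ m → totalWeight {m} ones ≡ m
  totalWeight-ones m = trans (∑-1 (allFin m)) (length-tabulate (λ i → i))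

  totalWeight-pathAdj : ∀ N {λ′} → λ′ ∈ partitions N → totalWeight {sumℕ λ′} ones ≡ N
  totalWeight-pathAdj N {λ′} λ′∈ = trans (totalWeight-ones (sumℕ λ′)) (proj₂ (∈-partitions⁻ N λ′∈))

  module _ {n} (adj : Adj n) (ω : Fin n → ℕ) (pos : Positive ω) (a : List ℕ → ℚ) (expansion : IsPathExpansion adj ω a) where

    private
      N = totalWeight ω

    numProperWithWeights-expansion : ∀ k (β : Fin k → ℕ) →
      fromℕℚ (numProperWithWeights adj ω k β)
        ≡ sumℚ (map (λ λ′ → a λ′ * fromℕℚ (numProperWithWeights (pathAdj λ′) ones k β)) (partitions N))
    numProperWithWeights-expansion k β = by-total (∑Fin k β ≟ N)
      where
      by-total : Dec (∑Fin k β ≡ N) →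
        fromℕℚ (numProperWithWeights adj ω k β)
          ≡ sumℚ (map (λ λ′ → a λ′ * fromℕℚ (numProperWithWeights (pathAdj λ′) ones k β)) (partitions N))
      by-total (yes ∑β≡N) = begin
        fromℕℚ (numProperWithWeights adj ω k β)
          ≡⟨ cong fromℕℚ (numProperWithWeights≡coeffX adj ω pos k β) ⟩
        fromℕℚ (coeffX adj ω (partitionOf k β))
          ≡⟨ expansion (partitionOf k β) (partitionOf∈partitions k β N ∑β≡N) ⟩
        sumℚ (map (λ λ′ → a λ′ * fromℕℚ (coeffP λ′ (partitionOf k β))) (partitions N))
          ≡⟨ sumℚ-cong (partitions N) (λ λ′ _ →
               cong (λ t → a λ′ * fromℕℚ t) (numProperWithWeights≡coeffX (pathAdj λ′) ones (λ _ → ℕ.s≤s ℕ.z≤n) k β)) ⟨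
        sumℚ (map (λ λ′ → a λ′ * fromℕℚ (numProperWithWeights (pathAdj λ′) ones k β)) (partitions N)) ∎
        where open ≡-Reasoning
      by-total (no ∑β≢N) = trans (cong fromℕℚ (numProperWithWeights-wrongTotal adj ω k β ∑β≢N))
        (sym (sumℚ-zero (partitions N) λ λ′ λ′∈ →
          trans (cong (λ t → a λ′ * fromℕℚ t)
                      (numProperWithWeights-wrongTotal (pathAdj λ′) ones k β (λ ∑β≡ → ∑β≢N (trans ∑β≡ (totalWeight-pathAdj N λ′∈)))))
                (*-zeroʳ (a λ′))))

    numProper-expansion : ∀ k →
      fromℕℚ (numProper adj k) ≡ sumℚ (map (λ λ′ → a λ′ * fromℕℚ (numProper (pathAdj λ′) k)) (partitions N))
    numProper-expansion k = begin
      fromℕℚ (numProper adj k)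
        ≡⟨ cong fromℕℚ (numProper≡∑numProperWithWeights adj ω k N ≤-refl) ⟩
      fromℕℚ (∑ vectors (λ α → numProperWithWeights adj ω k (weights α)))
        ≡⟨ fromℕℚ-∑ vectors (λ α → numProperWithWeights adj ω k (weights α)) ⟩
      sumℚ (map (λ α → fromℕℚ (numProperWithWeights adj ω k (weights α))) vectors)
        ≡⟨ sumℚ-cong vectors (λ α _ → numProperWithWeights-expansion k (weights α)) ⟩
      sumℚ (map (λ α → sumℚ (map (λ λ′ → a λ′ * pathCount λ′ α) (partitions N))) vectors)
        ≡⟨ sumℚ-comm vectors (partitions N) (λ α λ′ → a λ′ * pathCount λ′ α) ⟩
      sumℚ (map (λ λ′ → sumℚ (map (λ α → a λ′ * pathCount λ′ α) vectors)) (partitions N))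
        ≡⟨ sumℚ-cong (partitions N) (λ λ′ λ′∈ → trans (sumℚ-*ˡ vectors (a λ′) (pathCount λ′)) (cong (a λ′ *_) (collect λ′ λ′∈))) ⟩
      sumℚ (map (λ λ′ → a λ′ * fromℕℚ (numProper (pathAdj λ′) k)) (partitions N)) ∎
      where
      open ≡-Reasoning
      vectors = allMaps k (suc N)
      weights = λ α (i : Fin k) → toℕ (lookup α i)
      pathCount = λ λ′ α → fromℕℚ (numProperWithWeights (pathAdj λ′) ones k (weights α))
      collect : ∀ λ′ → λ′ ∈ partitions N → sumℚ (map (pathCount λ′) vectors) ≡ fromℕℚ (numProper (pathAdj λ′) k)
      collect λ′ λ′∈ = trans (sym (fromℕℚ-∑ vectors (λ α → numProperWithWeights (pathAdj λ′) ones k (weights α))))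
        (cong fromℕℚ (sym (numProper≡∑numProperWithWeights (pathAdj λ′) ones k N (≤-reflexive (totalWeight-pathAdj N λ′∈)))))

  pathExpansionPoly : ℕ → (List ℕ → ℚ) → ℚ → ℚ
  pathExpansionPoly N a x = sumℚ (map (λ λ′ → a λ′ * (x ^ℚ length λ′ * (x - 1ℚ) ^ℚ (N ∸ length λ′))) (partitions N))

  pathExpansionPoly-isPolynomial : ∀ N a → IsPolynomial (pathExpansionPoly N a)
  pathExpansionPoly-isPolynomial N a = sum-isPolynomial (partitions N) _ λ λ′ →
    *-isPolynomial (const-isPolynomial (a λ′))
      (*-isPolynomial (^-isPolynomial id-isPolynomial (length λ′))
                      (^-isPolynomial (+-isPolynomial id-isPolynomial (const-isPolynomial (- 1ℚ))) (N ∸ length λ′)))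

  chromatic-pathExpansion : ∀ {n} (adj : Adj n) ω → Positive ω → ∀ a → IsPathExpansion adj ω a →
    ∀ χ → IsChromaticPoly adj χ → ∀ x → evalPoly χ x ≡ pathExpansionPoly (totalWeight ω) a x
  chromatic-pathExpansion adj ω pos a expansion χ χ-chromatic =
    polynomials-agree-on-ℕ⁺ (χ , λ _ → refl) (pathExpansionPoly-isPolynomial N a) λ k → begin
      evalPoly χ (fromℕℚ (suc k))
        ≡⟨ χ-chromatic (suc k) ⟩
      fromℕℚ (numProper adj (suc k))
        ≡⟨ numProper-expansion adj ω pos a expansion (suc k) ⟩
      sumℚ (map (λ λ′ → a λ′ * fromℕℚ (numProper (pathAdj λ′) (suc k))) (partitions N))
        ≡⟨ sumℚ-cong (partitions N) (λ λ′ λ′∈ → cong (a λ′ *_) (pathCount λ′ λ′∈ k)) ⟩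
      pathExpansionPoly N a (fromℕℚ (suc k)) ∎
    where
    open ≡-Reasoning
    N = totalWeight ω
    pathCount : ∀ λ′ → λ′ ∈ partitions N → ∀ k →
      fromℕℚ (numProper (pathAdj λ′) (suc k))
        ≡ fromℕℚ (suc k) ^ℚ length λ′ * (fromℕℚ (suc k) - 1ℚ) ^ℚ (N ∸ length λ′)
    pathCount λ′ λ′∈ k = begin
      fromℕℚ (numProper (pathAdj λ′) (suc k))
        ≡⟨ cong fromℕℚ (numProper-pathAdj λ′ (proj₁ (∈-partitions⁻ N λ′∈)) (suc k)) ⟩
      fromℕℚ (suc k ℕ.^ length λ′ ℕ.* k ℕ.^ (sumℕ λ′ ∸ length λ′))
        ≡⟨ cong (λ s → fromℕℚ (suc k ℕ.^ length λ′ ℕ.* k ℕ.^ (s ∸ length λ′))) (proj₂ (∈-partitions⁻ N λ′∈)) ⟩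
      fromℕℚ (suc k ℕ.^ length λ′ ℕ.* k ℕ.^ (N ∸ length λ′))
        ≡⟨ trans (fromℕℚ-* (suc k ℕ.^ length λ′) (k ℕ.^ (N ∸ length λ′))) (cong₂ _*_ (fromℕℚ-^ (suc k) (length λ′)) (fromℕℚ-^ k (N ∸ length λ′))) ⟩
      fromℕℚ (suc k) ^ℚ length λ′ * fromℕℚ k ^ℚ (N ∸ length λ′)
        ≡⟨ cong (λ t → fromℕℚ (suc k) ^ℚ length λ′ * t ^ℚ (N ∸ length λ′)) k≡[k+1]-1 ⟩
      fromℕℚ (suc k) ^ℚ length λ′ * (fromℕℚ (suc k) - 1ℚ) ^ℚ (N ∸ length λ′) ∎
      where
      k≡[k+1]-1 : fromℕℚ k ≡ fromℕℚ (suc k) - 1ℚ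
      k≡[k+1]-1 = trans (solve 1 (λ t → t := (con 1ℚ :+ t) :- con 1ℚ) refl (fromℕℚ k))
                        (cong (_- 1ℚ) (sym (fromℕℚ-suc k)))

  pathExpansionPoly≡treePoly : ∀ N a x (x≢1 : x - 1ℚ ≢ 0ℚ) →
    pathExpansionPoly N a x ≡ (x - 1ℚ) ^ℚ N * treePoly N a (divℚ x (x - 1ℚ) x≢1)
  pathExpansionPoly≡treePoly N a x x≢1 =
    trans (sumℚ-cong (partitions N) term) (sumℚ-*ˡ (partitions N) ((x - 1ℚ) ^ℚ N) (λ λ′ → a λ′ * y ^ℚ length λ′))
    where
    y = divℚ x (x - 1ℚ) x≢1
    term : ∀ λ′ → λ′ ∈ partitions N →
      a λ′ * (x ^ℚ length λ′ * (x - 1ℚ) ^ℚ (N ∸ length λ′)) ≡ (x - 1ℚ) ^ℚ N * (a λ′ * y ^ℚ length λ′)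
    term λ′ λ′∈ = begin
      a λ′ * (x ^ℚ ℓ * (x - 1ℚ) ^ℚ (N ∸ ℓ))
        ≡⟨ cong (λ t → a λ′ * (t ^ℚ ℓ * (x - 1ℚ) ^ℚ (N ∸ ℓ))) (*-divℚ x (x - 1ℚ) x≢1) ⟨
      a λ′ * (((x - 1ℚ) * y) ^ℚ ℓ * (x - 1ℚ) ^ℚ (N ∸ ℓ))
        ≡⟨ cong (λ t → a λ′ * (t * (x - 1ℚ) ^ℚ (N ∸ ℓ))) (*-^ℚ (x - 1ℚ) y ℓ) ⟩
      a λ′ * ((x - 1ℚ) ^ℚ ℓ * y ^ℚ ℓ * (x - 1ℚ) ^ℚ (N ∸ ℓ))
        ≡⟨ solve 4 (λ A B C D → A :* ((B :* C) :* D) := (B :* D) :* (A :* C)) refl (a λ′) ((x - 1ℚ) ^ℚ ℓ) (y ^ℚ ℓ) ((x - 1ℚ) ^ℚ (N ∸ ℓ)) ⟩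
      (x - 1ℚ) ^ℚ ℓ * (x - 1ℚ) ^ℚ (N ∸ ℓ) * (a λ′ * y ^ℚ ℓ)
        ≡⟨ cong (_* (a λ′ * y ^ℚ ℓ)) (^ℚ-+ (x - 1ℚ) ℓ (N ∸ ℓ)) ⟨
      (x - 1ℚ) ^ℚ (ℓ ℕ.+ (N ∸ ℓ)) * (a λ′ * y ^ℚ ℓ)
        ≡⟨ cong (λ e → (x - 1ℚ) ^ℚ e * (a λ′ * y ^ℚ ℓ)) (m+[n∸m]≡n ℓ≤N) ⟩
      (x - 1ℚ) ^ℚ N * (a λ′ * y ^ℚ ℓ) ∎
      where
      open ≡-Reasoning
      ℓ = length λ′
      ℓ≤N : ℓ ≤ N
      ℓ≤N = ≤-trans (length≤sum λ′ (proj₁ (∈-partitions⁻ N λ′∈))) (≤-reflexive (proj₂ (∈-partitions⁻ N λ′∈)))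

open import Defs
open import Data.Nat using (ℕ)
open import Data.Fin using (Fin)
open import Data.List using (List)
open import Data.Product using (_×_; _,_)
open import Data.Rational using (ℚ; 0ℚ; 1ℚ; _-_; _*_)
open import Relation.Binary.PropositionalEquality using (_≡_; _≢_; trans)
open Rationals using (x/[x-1]-involution)
open PathExpansion using (chromatic-pathExpansion; pathExpansionPoly≡treePoly)

theorem4p4 : (n : ℕ) (adj : Adj n) → IsSimple adj →
  (ω : Fin n → ℕ) → Positive ω →
  (a : List ℕ → ℚ) → IsPathExpansion adj ω a →
  (χ : List ℚ) → IsChromaticPoly adj χ →
  ((x : ℚ) (h : x - 1ℚ ≢ 0ℚ) →
      evalPoly χ x ≡ ((x - 1ℚ) ^ℚ totalWeight ω) * treePoly (totalWeight ω) a (divℚ x (x - 1ℚ) h))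
  × ((x : ℚ) (h : x - 1ℚ ≢ 0ℚ) →
      treePoly (totalWeight ω) a x ≡ ((x - 1ℚ) ^ℚ totalWeight ω) * evalPoly χ (divℚ x (x - 1ℚ) h))
theorem4p4 n adj _ ω pos a expansion χ χ-chromatic =
  chromatic≡treePoly , x/[x-1]-involution (totalWeight ω) (evalPoly χ) (treePoly (totalWeight ω) a) chromatic≡treePoly
  where
  chromatic≡treePoly : ∀ x (x≢1 : x - 1ℚ ≢ 0ℚ) →
    evalPoly χ x ≡ (x - 1ℚ) ^ℚ totalWeight ω * treePoly (totalWeight ω) a (divℚ x (x - 1ℚ) x≢1)
  chromatic≡treePoly x x≢1 = trans (chromatic-pathExpansion adj ω pos a expansion χ χ-chromatic x)
                                   (pathExpansionPoly≡treePoly (totalWeight ω) a x x≢1)
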